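{- If $v$ is a vertex of a simple graph $G$ and $e$ is any edge incident with $v$, then for at least two choices of $H$ among $G-v$, $(G\times e)-v$, $(G*v)-v$, no tangle of $\mathrm{CR}(G)$ splits in $\mathrm{CR}(H)$; that is, for every positive integer $k$ and every tangle $\mathcal{T}$ of order $k$ in $\mathrm{CR}(G)$, there do not exist two distinct tangles of order $k$ in $\mathrm{CR}(H)$ that both induce $\mathcal{T}$.
   Context: For a simple graph $G$ with vertex set $V$ and adjacency matrix $A$, the cut-rank $\rho_G(X)$ of $X\subseteq V$ is the rank over $\mathrm{GF}(2)$ of $A[X,V\setminus X]$, and $\mathrm{CR}(G)=(V,\rho_G)$; this is a connectivity system, i.e. $\rho_G(X)=\rho_G(V\setminus X)$ and $\rho_G$ is submodular. For a vertex $w$, the local complement $G*w$ is obtained by replacing the subgraph induced on the neighbourhood of $w$ by its complement; for an edge $e=uw$, $G\times e=G*u*w*u$. For a connectivity system $K=(E,\lambda)$, $\mathcal S_k(K)$ is the set of $X\subseteq E$ with $\lambda(X)<k$; a tangle of order $k$ in $K$ is a set $\mathcal{T}\subseteq\mathcal S_k(K)$ such that for each $A\in\mathcal S_k(K)$ exactly one of $A$, $E\setminus A$ lies in $\mathcal{T}$, there are no $T_1,T_2,T_3\in\mathcal{T}$ with $T_1\cup T_2\cup T_3=E$, and no set in $\mathcal{T}$ has size $|E|-1$. For a graph $H$ with $V(H)\subseteq V(G)$ and a tangle $\mathcal{T}_0$ of order $k$ in $\mathrm{CR}(H)$, the tangle of $\mathrm{CR}(G)$ induced by $\mathcal{T}_0$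 is $\{X\in\mathcal S_k(\mathrm{CR}(G)): X\cap V(H)\in\mathcal{T}_0\}$. A tangle $\mathcal{T}$ of order $k$ in $\mathrm{CR}(G)$ splits in $\mathrm{CR}(H)$ if two distinct tangles of order $k$ in $\mathrm{CR}(H)$ both induce $\mathcal{T}$. -}

module Defs where

open import Data.Bool using (Bool; true; false; _∧_; _∨_; _xor_; not)
open import Data.Nat using (ℕ; zero; suc; _≤_; _<_)
open import Data.Fin using (Fin; zero; suc; _≟_)
open import Data.Fin.Subset using (Subset; _∈_; _∉_; _⊆_; _∩_; _∪_; _─_; ∁; ⁅_⁆; ∣_∣; ⊤; Nonempty)
open import Data.Vec using (lookup)
open import Data.Product using (Σ; ∃; _×_; _,_)
open import Data.Sum using (_⊎_)
open import Relation.Nullary using (¬_; ⌊_⌋)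
open import Relation.Binary.PropositionalEquality using (_≡_; _≢_)

-- Graphs on the vertex set Fin n, given by an adjacency matrix over GF(2)
-- (Bool, with _xor_ as addition and _∧_ as multiplication).

Adj : ℕ → Set
Adj n = Fin n → Fin n → Bool

Simple : ∀ {n} → Adj n → Set
Simple A = (∀ x y → A x y ≡ A y x) × (∀ x → A x x ≡ false)

-- local complementation at w: complement the subgraph induced on N(w)
_*_ : ∀ {n} → Adj n → Fin n → Adj n
(A * w) x y = A x y xor (A w x ∧ A w y ∧ not ⌊ x ≟ y ⌋)

pivot : ∀ {n} → Adj n → Fin n → Fin n → Adj n
pivot A u w = ((A * u) * w) * u

parity : ∀ {n} → (Fin n → Bool) → Bool
parity {zero}  f = false
parity {suc n} f = f zero xor parity (λ x → f (suc x))

RowsIndependent : ∀ {n} → Adj n → Subset n → Subset n → Set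
RowsIndependent {n} M C Q =
  (P : Subset n) → P ⊆ Q → Nonempty P →
  ∃ λ c → c ∈ C × parity (λ x → lookup P x ∧ M x c) ≡ true

RankLt : ∀ {n} → Adj n → Subset n → Subset n → ℕ → Set
RankLt M R C k = (Q : Subset _) → Q ⊆ R → ∣ Q ∣ ≡ k → ¬ RowsIndependent M C Q

-- Cut-rank connectivity system of a graph with adjacency A on ground set
-- W ⊆ Fin n (the induced subgraph on W).  ρ(X) = rank A[X, W ∖ X].

CutRankLt : ∀ {n} → Adj n → Subset n → Subset n → ℕ → Set
CutRankLt A W X k = RankLt A X (W ─ X) k

InS : ∀ {n} → Adj n → Subset n → ℕ → Subset n → Set
InS A W k X = X ⊆ W × CutRankLt A W X k

Family : ℕ → Set
Family n = Subset n → Bool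

record IsTangle {n} (A : Adj n) (W : Subset n) (k : ℕ) (T : Family n) : Set where
  field
    inS       : ∀ X → T X ≡ true → InS A W k X
    oneOf     : ∀ X → InS A W k X → T X ≡ true ⊎ T (W ─ X) ≡ true
    notBoth   : ∀ X → InS A W k X → ¬ (T X ≡ true × T (W ─ X) ≡ true)
    noCover   : ∀ X Y Z → T X ≡ true → T Y ≡ true → T Z ≡ true → X ∪ Y ∪ Z ≢ W
    noCoSingl : ∀ X → T X ≡ true → suc ∣ X ∣ ≢ ∣ W ∣

-- The tangle of CR(G) (ground set all of Fin n) induced by the tangle T₀ of
-- CR(H), where H has adjacency B on ground set W, is exactly T.
Induces : ∀ {n} → Adj n → ℕ → Subset n → Family n → Family n → Set
Induces A k W T₀ T =
  ∀ X → (T X ≡ true → InS A ⊤ k X × T₀ (X ∩ W) ≡ true)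
      × (InS A ⊤ k X → T₀ (X ∩ W) ≡ true → T X ≡ true)

NoSplit : ∀ {n} → Adj n → Adj n → Subset n → Set
NoSplit A B W =
  ∀ k → 1 ≤ k → ∀ T → IsTangle A ⊤ k T →
  ∀ T₁ T₂ → IsTangle B W k T₁ → IsTangle B W k T₂ →
  Induces A k W T₁ T → Induces A k W T₂ T →
  ∀ X → T₁ X ≡ T₂ X

AtLeastTwo : Set → Set → Set → Set
AtLeastTwo P Q R = (P × Q) ⊎ (P × R) ⊎ (Q × R)

-- Suppose a tangle of order k of CR(G) splits in two of the minors, in the first by a set X (X lies
-- in one of the two tangles and W ─ X in the other, W = V ─ v) and in the second by Y (order l).
-- For each pair of minors there is a matrix M with ρ₁(X) ≥ rank M[X, W ─ X] and
-- ρ₂(Y) + 1 ≥ rank M[Y + v, (W ─ Y) + v], which is at least as large as A on the relevant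
-- submatrices: A itself for G - v and (G × vu) - v, A with a loop at v for G - v and (G * v) - v,
-- and the matrix of G * v for (G * v) - v and (G × vu) - v. Submodularity of the rank of
-- submatrices then gives ρ_G(X ∩ Y) + ρ_G(X ∪ Y ∪ v) ≤ ρ₁(X) + ρ₂(Y) + 1, and the same with Y
-- replaced by W ─ Y, so enough of the four corners are small in G. Two tangles of a minor that
-- induce the same tangle of G agree on small sets, and a case analysis on k ≤ l or l ≤ k turns
-- the small corners into three sets of one of the split tangles that cover W. As splitting is
-- decidable, at least two of the three minors have no split.

module Submission where

open import Defs

import Algebra.Lattice.Properties.BooleanAlgebra as BooleanAlgebraProperties
open import Algebra.Solver.Ring.AlmostCommutativeRing using (fromCommutativeRing)
import Algebra.Solver.Ring.Simple as RingSolver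
open import Data.Bool using (Bool; true; false; _∧_; _∨_; _xor_; not; if_then_else_)
import Data.Bool as Bool
open import Data.Bool.Properties
  using ( xor-∧-commutativeRing; xor-identityʳ; xor-same; xor-assoc; ∧-distribʳ-xor; ∧-zeroʳ; ∧-identityʳ
        ; ∧-comm; ∧-conicalˡ; ∧-conicalʳ; ¬-not; ∨-identityʳ; ∨-zeroʳ)
  renaming (_≟_ to _≟ᵇ_)
open import Data.Empty using (⊥; ⊥-elim)
open import Data.Fin using (Fin; zero; suc; _≟_; combine; remQuot; splitAt; join; _↑ˡ_; _↑ʳ_)
open import Data.Fin.Properties
  using (remQuot-combine; combine-remQuot; injective⇒≤; any?; splitAt-↑ˡ; splitAt-↑ʳ; join-splitAt)
open import Data.Fin.Subset using (Subset; _∈_; _∉_; _⊆_; _∩_; _∪_; _─_; ∁; ⁅_⁆; ⊤; ∣_∣; Nonempty)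
  renaming (⊥ to ∅)
open import Data.Fin.Subset.Properties
  using ( _∈?_; _⊆?_; nonempty?; anySubset?; ∉⊥; ∈⊤; ⊥⊆; ⊆⊤; ⊆-refl; ⊆-reflexive; ⊆-trans; ⊆-antisym
        ; drop-∷-⊆; s⊆s; x∈⁅x⁆; x∈⁅y⁆⇒x≡y; p⊆p∪q; q⊆p∪q; x∈p∪q⁻; x∈p∩q⁺; p∩q⊆p; p∩q⊆q
        ; x∈p⇒x∉∁p; x∉p⇒x∈∁p; x∈p∧x∉q⇒x∈p─q; p─q⊆p; p─⊥≡p; ∣p∣≤n; ∣⊥∣≡0; p⊆q⇒∣p∣≤∣q∣
        ; ∪-∩-booleanAlgebra)
open import Data.List using (List; []; _∷_; allFin)
import Data.List.Membership.Propositional as List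
open import Data.List.Membership.Propositional.Properties using (∈-allFin)
import Data.List.Relation.Unary.Any as Any
open import Data.Nat using (ℕ; zero; suc; _+_; _≤_; _<_; _^_; _≤?_; s≤s; z≤n) renaming (_≟_ to _≟ℕ_)
open import Data.Nat.Properties
  using ( <⇒≱; ≰⇒>; ^-monoʳ-<; +-suc; +-comm; +-mono-≤; +-cancelʳ-≤; <-irrefl; ≤-trans; ≤-reflexive
        ; ≤-total; n<1+n; ≤-pred; m≤n⇒m≤1+n; +-commutativeSemigroup; anyUpTo?; module ≤-Reasoning)
open import Algebra.Properties.CommutativeSemigroup +-commutativeSemigroup
  using () renaming (interchange to +-interchange)
open import Data.Product using (Σ; ∃; _×_; _,_; proj₁; proj₂)
open import Data.Sum using (_⊎_; inj₁; inj₂; [_,_]′)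
import Data.Sum
open import Data.Vec using (Vec; []; _∷_; _++_; lookup; zipWith; tabulate; here; there)
import Data.Vec
open import Data.Vec.Properties
  using ( []=⇒lookup; lookup⇒[]=; lookup-zipWith; lookup-map; lookup-replicate; tabulate∘lookup; tabulate-cong
        ; lookup∘tabulate; zipWith-++; ≡-dec)
open import Function using (id; _∘_; case_of_; _⟨_⟩_)
open import Relation.Nullary
  using ( ¬_; Dec; yes; no; ⌊_⌋; contradiction; ¬?; _×-dec_; _⊎-dec_; _→-dec_; map′; decidable-stable; toSum)
open import Relation.Binary.PropositionalEquality
  using (_≡_; _≢_; refl; sym; trans; cong; cong₂; subst; module ≡-Reasoning)

open RingSolver (fromCommutativeRing xor-∧-commutativeRing) _≟ᵇ_ using (solve; _:=_; _:+_; _:*_)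

parity-cong : ∀ {n} {f g : Fin n → Bool} → (∀ x → f x ≡ g x) → parity f ≡ parity g
parity-cong {zero}  h = refl
parity-cong {suc n} h = cong₂ _xor_ (h zero) (parity-cong (λ x → h (suc x)))

parity-false : ∀ {n} → parity {n} (λ _ → false) ≡ false
parity-false {zero}  = refl
parity-false {suc n} = parity-false {n}

parity-xor : ∀ {n} (f g : Fin n → Bool) → parity (λ x → f x xor g x) ≡ parity f xor parity g
parity-xor {zero}  f g = refl
parity-xor {suc n} f g =
  trans (cong ((f zero xor g zero) xor_) (parity-xor (λ x → f (suc x)) (λ x → g (suc x))))
        (solve 4 (λ a b c d → (a :+ b) :+ (c :+ d) := (a :+ c) :+ (b :+ d)) refl
               (f zero) (g zero) (parity (λ x → f (suc x))) (parity (λ x → g (suc x))))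

parity-∧ˡ : ∀ {n} b (f : Fin n → Bool) → parity (λ x → b ∧ f x) ≡ b ∧ parity f
parity-∧ˡ true  f = refl
parity-∧ˡ {n} false f = parity-false {n}

parity-∧ʳ : ∀ {n} b (f : Fin n → Bool) → parity (λ x → f x ∧ b) ≡ parity f ∧ b
parity-∧ʳ b f =
  trans (parity-cong (λ x → ∧-comm (f x) b)) (trans (parity-∧ˡ b f) (∧-comm b _))

parity-swap : ∀ {n m} (f : Fin n → Fin m → Bool) →
  parity (λ y → parity (λ x → f x y)) ≡ parity (λ x → parity (λ y → f x y))
parity-swap {zero} {m} f = parity-false {m}
parity-swap {suc n} {m} f =
  trans (parity-xor (λ y → f zero y) (λ y → parity (λ x → f (suc x) y)))
        (cong (parity (f zero) xor_) (parity-swap (λ x y → f (suc x) y)))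

parity≡true⇒∃ : ∀ {n} (f : Fin n → Bool) → parity f ≡ true → ∃ λ x → f x ≡ true
parity≡true⇒∃ {suc n} f e with f zero in ez
... | true  = zero , ez
... | false = let (x , ex) = parity≡true⇒∃ (λ x → f (suc x)) e in suc x , ex

δ : ∀ {n} → Fin n → Fin n → Bool
δ x y = ⌊ x ≟ y ⌋

δ-≡ : ∀ {n} {x y : Fin n} → x ≡ y → δ x y ≡ true
δ-≡ {x = x} {y} e with x ≟ y
... | yes _ = refl
... | no ne = ⊥-elim (ne e)

δ-≢ : ∀ {n} {x y : Fin n} → x ≢ y → δ x y ≡ false
δ-≢ {x = x} {y} ne with x ≟ y
... | yes e = ⊥-elim (ne e)
... | no _  = refl

δ-refl : ∀ {n} (x : Fin n) → δ x x ≡ true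
δ-refl x = δ-≡ refl

δ≡true⇒≡ : ∀ {n} {x y : Fin n} → δ x y ≡ true → x ≡ y
δ≡true⇒≡ {x = x} {y} e with x ≟ y
... | yes p = p

δ-suc : ∀ {n} (x y : Fin n) → δ (suc x) (suc y) ≡ δ x y
δ-suc x y with x ≟ y
... | yes _ = refl
... | no _  = refl

parity-δ : ∀ {n} (x : Fin n) (f : Fin n → Bool) → parity (λ z → δ z x ∧ f z) ≡ f x
parity-δ {suc n} zero f =
  trans (cong (f zero xor_) (trans (parity-cong (λ z → cong (_∧ f (suc z)) (δ-≢ {x = suc z} {zero} (λ ()))))
                                   (parity-false {n})))
        (xor-identityʳ (f zero))
parity-δ {suc n} (suc x) f =
  trans (parity-cong (λ z → cong (_∧ f (suc z)) (δ-suc z x))) (parity-δ x (λ z → f (suc z)))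

false≢true : false ≢ true
false≢true ()

∈⇒lookup : ∀ {n} {p : Subset n} {x} → x ∈ p → lookup p x ≡ true
∈⇒lookup = []=⇒lookup

lookup⇒∈ : ∀ {n} {p : Subset n} {x} → lookup p x ≡ true → x ∈ p
lookup⇒∈ {p = p} {x} = lookup⇒[]= x p

⊆-intro : ∀ {n} {p q : Subset n} → (∀ x → lookup p x ≡ true → lookup q x ≡ true) → p ⊆ q
⊆-intro h {x} x∈p = lookup⇒∈ (h x (∈⇒lookup x∈p))

⊆-elim : ∀ {n} {p q : Subset n} → p ⊆ q → ∀ x → lookup p x ≡ true → lookup q x ≡ true
⊆-elim h x e = ∈⇒lookup (h (lookup⇒∈ e))

lookup-ext : ∀ {n} {p q : Subset n} → (∀ x → lookup p x ≡ lookup q x) → p ≡ q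
lookup-ext {p = p} {q} h = trans (sym (tabulate∘lookup p)) (trans (tabulate-cong h) (tabulate∘lookup q))

lookup-∩ : ∀ {n} (p q : Subset n) x → lookup (p ∩ q) x ≡ lookup p x ∧ lookup q x
lookup-∩ p q x = lookup-zipWith _∧_ x p q

lookup-∪ : ∀ {n} (p q : Subset n) x → lookup (p ∪ q) x ≡ lookup p x ∨ lookup q x
lookup-∪ p q x = lookup-zipWith _∨_ x p q

lookup-∁ : ∀ {n} (p : Subset n) x → lookup (∁ p) x ≡ not (lookup p x)
lookup-∁ p x = lookup-map x not p

lookup-─ : ∀ {n} (p q : Subset n) x → lookup (p ─ q) x ≡ lookup p x ∧ not (lookup q x)
lookup-─ (a ∷ p) (true  ∷ q) zero    = sym (∧-zeroʳ a)
lookup-─ (a ∷ p) (false ∷ q) zero    = sym (∧-identityʳ a)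
lookup-─ (a ∷ p) (b     ∷ q) (suc x) = lookup-─ p q x

x∈p─q⇒x∉q : ∀ {n} {p q : Subset n} {x} → x ∈ p ─ q → x ∉ q
x∈p─q⇒x∉q {p = p} {q} {x} x∈ x∈q =
  false≢true (trans (sym (trans (lookup-─ p q x) (trans (cong (λ t → lookup p x ∧ not t) (∈⇒lookup x∈q)) (∧-zeroʳ _))))
                    (∈⇒lookup x∈))

lookup-⊤ : ∀ {n} x → lookup (⊤ {n}) x ≡ true
lookup-⊤ x = lookup-replicate x true

lookup-∅ : ∀ {n} x → lookup (∅ {n}) x ≡ false
lookup-∅ x = lookup-replicate x false

lookup-⁅⁆ : ∀ {n} (y x : Fin n) → lookup ⁅ y ⁆ x ≡ δ x y
lookup-⁅⁆ zero    zero    = refl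
lookup-⁅⁆ zero    (suc x) = lookup-∅ x
lookup-⁅⁆ (suc y) zero    = refl
lookup-⁅⁆ (suc y) (suc x) = trans (lookup-⁅⁆ y x) (sym (δ-suc x y))

xor≡false⇒≡ : ∀ {a b} → a xor b ≡ false → a ≡ b
xor≡false⇒≡ {true}  {true}  _ = refl
xor≡false⇒≡ {false} {false} _ = refl

xor-cancelʳ : ∀ a b → (a xor b) xor b ≡ a
xor-cancelʳ a b = trans (xor-assoc a b b) (trans (cong (a xor_) (xor-same b)) (xor-identityʳ a))

infixl 6 _⊕_

_⊕_ : ∀ {n} → Subset n → Subset n → Subset n
p ⊕ q = zipWith _xor_ p q

lookup-⊕ : ∀ {n} (p q : Subset n) x → lookup (p ⊕ q) x ≡ lookup p x xor lookup q x
lookup-⊕ p q x = lookup-zipWith _xor_ x p q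

∪-least : ∀ {n} {p q r : Subset n} → p ⊆ r → q ⊆ r → p ∪ q ⊆ r
∪-least {p = p} {q} a b x∈ = [ a , b ]′ (x∈p∪q⁻ p q x∈)

∩-greatest : ∀ {n} {r p q : Subset n} → r ⊆ p → r ⊆ q → r ⊆ p ∩ q
∩-greatest a b x∈ = x∈p∩q⁺ (a x∈ , b x∈)

⊕-least : ∀ {n} {p q r : Subset n} → p ⊆ r → q ⊆ r → p ⊕ q ⊆ r
⊕-least {p = p} {q} a b = ⊆-intro λ x e →
  member (lookup p x) (lookup q x) (⊆-elim a x) (⊆-elim b x) (trans (sym (lookup-⊕ p q x)) e)
  where
  member : ∀ s t {z} → (s ≡ true → z ≡ true) → (t ≡ true → z ≡ true) → s xor t ≡ true → z ≡ true
  member true  t f g e = f refl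
  member false t f g e = g e

⁅⁆⊆ : ∀ {n} (y : Fin n) {p : Subset n} → lookup p y ≡ true → ⁅ y ⁆ ⊆ p
⁅⁆⊆ y {p} e = ⊆-intro λ x ex → subst (λ z → lookup p z ≡ true) (sym (δ≡true⇒≡ (trans (sym (lookup-⁅⁆ y x)) ex))) e

rowSum : ∀ {m d} → Subset m → (Fin m → Fin d → Bool) → Fin d → Bool
rowSum P w c = parity (λ x → lookup P x ∧ w x c)

rowSum-⊕ : ∀ {m d} (P Q : Subset m) (w : Fin m → Fin d → Bool) c →
  rowSum (P ⊕ Q) w c ≡ rowSum P w c xor rowSum Q w c
rowSum-⊕ P Q w c =
  trans (parity-cong (λ x → trans (cong (_∧ w x c) (lookup-⊕ P Q x))
                                  (∧-distribʳ-xor (w x c) (lookup P x) (lookup Q x))))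
        (parity-xor (λ x → lookup P x ∧ w x c) (λ x → lookup Q x ∧ w x c))

rowSum-⁅⁆ : ∀ {m d} (y : Fin m) (w : Fin m → Fin d → Bool) c → rowSum ⁅ y ⁆ w c ≡ w y c
rowSum-⁅⁆ y w c = trans (parity-cong (λ x → cong (_∧ w x c) (lookup-⁅⁆ y x))) (parity-δ y (λ x → w x c))

rowSum-∅ : ∀ {m d} (w : Fin m → Fin d → Bool) c → rowSum (∅ {m}) w c ≡ false
rowSum-∅ {m} w c = trans (parity-cong (λ x → cong (_∧ w x c) (lookup-∅ x))) (parity-false {m})

rowSum-cong : ∀ {m d} (P : Subset m) (w w′ : Fin m → Fin d → Bool) c →
  (∀ x → lookup P x ≡ true → w x c ≡ w′ x c) → rowSum P w c ≡ rowSum P w′ c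
rowSum-cong P w w′ c h = parity-cong pointwise
  where
  pointwise : ∀ x → lookup P x ∧ w x c ≡ lookup P x ∧ w′ x c
  pointwise x with lookup P x in e
  ... | true  = h x e
  ... | false = refl

expand : ∀ {m} (Q : Subset m) → Vec Bool ∣ Q ∣ → Subset m
expand []          []      = []
expand (true  ∷ Q) (b ∷ v) = b ∷ expand Q v
expand (false ∷ Q) v       = false ∷ expand Q v

compress : ∀ {m} (Q : Subset m) → Subset m → Vec Bool ∣ Q ∣
compress []          []      = []
compress (true  ∷ Q) (b ∷ P) = b ∷ compress Q P
compress (false ∷ Q) (b ∷ P) = compress Q P

compress-expand : ∀ {m} (Q : Subset m) v → compress Q (expand Q v) ≡ v
compress-expand []          []      = refl
compress-expand (true  ∷ Q) (b ∷ v) = cong (b ∷_) (compress-expand Q v)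
compress-expand (false ∷ Q) v       = compress-expand Q v

expand-compress : ∀ {m} (Q P : Subset m) → P ⊆ Q → expand Q (compress Q P) ≡ P
expand-compress []          []          _ = refl
expand-compress (true  ∷ Q) (b ∷ P)     h = cong (b ∷_) (expand-compress Q P (drop-∷-⊆ h))
expand-compress (false ∷ Q) (true ∷ P)  h with h here
... | ()
expand-compress (false ∷ Q) (false ∷ P) h = cong (false ∷_) (expand-compress Q P (drop-∷-⊆ h))

expand⊆ : ∀ {m} (Q : Subset m) v → expand Q v ⊆ Q
expand⊆ Q v = ⊆-intro (go Q v)
  where
  go : ∀ {m} (Q : Subset m) v x → lookup (expand Q v) x ≡ true → lookup Q x ≡ true
  go (true  ∷ Q) (b ∷ v) zero    e = refl
  go (true  ∷ Q) (b ∷ v) (suc x) e = go Q v x e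
  go (false ∷ Q) v       (suc x) e = go Q v x e

Bool→Fin2 : Bool → Fin 2
Bool→Fin2 false = zero
Bool→Fin2 true  = suc zero

Fin2→Bool : Fin 2 → Bool
Fin2→Bool zero       = false
Fin2→Bool (suc zero) = true

encode : ∀ {a} → Vec Bool a → Fin (2 ^ a)
encode []            = zero
encode {suc a} (b ∷ v) = combine (Bool→Fin2 b) (encode v)

decode : ∀ a → Fin (2 ^ a) → Vec Bool a
decode zero    i = []
decode (suc a) i = let (b , j) = remQuot {2} (2 ^ a) i in Fin2→Bool b ∷ decode a j

decode-encode : ∀ {a} (v : Vec Bool a) → decode a (encode v) ≡ v
decode-encode []            = refl
decode-encode {suc a} (b ∷ v) =
  trans (cong (λ p → Fin2→Bool (proj₁ p) ∷ decode a (proj₂ p)) (remQuot-combine {2} {2 ^ a} (Bool→Fin2 b) (encode v)))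
        (cong₂ _∷_ (Fin2→Bool→Fin2 b) (decode-encode v))
  where
  Fin2→Bool→Fin2 : ∀ b → Fin2→Bool (Bool→Fin2 b) ≡ b
  Fin2→Bool→Fin2 true  = refl
  Fin2→Bool→Fin2 false = refl

encode-decode : ∀ a (i : Fin (2 ^ a)) → encode (decode a i) ≡ i
encode-decode zero    zero = refl
encode-decode (suc a) i =
  let (b , j) = remQuot {2} (2 ^ a) i
  in trans (cong₂ combine (Bool→Fin2→Bool b) (encode-decode a j)) (combine-remQuot {2} (2 ^ a) i)
  where
  Bool→Fin2→Bool : ∀ i → Bool→Fin2 (Fin2→Bool i) ≡ i
  Bool→Fin2→Bool zero       = refl
  Bool→Fin2→Bool (suc zero) = refl

2^-cancel-≤ : ∀ {a b} → 2 ^ a ≤ 2 ^ b → a ≤ b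
2^-cancel-≤ {a} {b} h with a ≤? b
... | yes a≤b = a≤b
... | no  a≰b = contradiction h (<⇒≱ (^-monoʳ-< 2 (s≤s (s≤s z≤n)) (≰⇒> a≰b)))

Bool-vector-pigeonhole : ∀ {a b} (g : Vec Bool a → Vec Bool b) → (∀ u v → g u ≡ g v → u ≡ v) → a ≤ b
Bool-vector-pigeonhole {a} {b} g inj = 2^-cancel-≤ (injective⇒≤ {f = h} h-injective)
  where
  h : Fin (2 ^ a) → Fin (2 ^ b)
  h i = encode (g (decode a i))
  h-injective : ∀ {i j} → h i ≡ h j → i ≡ j
  h-injective {i} {j} e = begin
    i                      ≡⟨ encode-decode a i ⟨
    encode (decode a i)    ≡⟨ cong encode (inj _ _ g-equal) ⟩
    encode (decode a j)    ≡⟨ encode-decode a j ⟩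
    j                      ∎
    where
    open ≡-Reasoning
    g-equal : g (decode a i) ≡ g (decode a j)
    g-equal = trans (sym (decode-encode _)) (trans (cong (decode b) e) (decode-encode _))

card-≤-by-injection : ∀ {m} (Q B : Subset m) (f : Subset m → Subset m) →
  (∀ P → P ⊆ Q → f P ⊆ B) → (∀ P P′ → P ⊆ Q → P′ ⊆ Q → f P ≡ f P′ → P ≡ P′) → ∣ Q ∣ ≤ ∣ B ∣
card-≤-by-injection Q B f f⊆B f-injective = Bool-vector-pigeonhole g g-injective
  where
  g : Vec Bool ∣ Q ∣ → Vec Bool ∣ B ∣
  g v = compress B (f (expand Q v))
  g-injective : ∀ u v → g u ≡ g v → u ≡ v
  g-injective u v e = begin
    u                        ≡⟨ compress-expand Q u ⟨
    compress Q (expand Q u)  ≡⟨ cong (compress Q) (f-injective _ _ (expand⊆ Q u) (expand⊆ Q v) f-equal) ⟩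
    compress Q (expand Q v)  ≡⟨ compress-expand Q v ⟩
    v                        ∎
    where
    open ≡-Reasoning
    f-equal : f (expand Q u) ≡ f (expand Q v)
    f-equal = begin
      f (expand Q u)      ≡⟨ expand-compress B _ (f⊆B _ (expand⊆ Q u)) ⟨
      expand B (g u)      ≡⟨ cong (expand B) e ⟩
      expand B (g v)      ≡⟨ expand-compress B _ (f⊆B _ (expand⊆ Q v)) ⟩
      f (expand Q v)      ∎

-- RowsIndependent and RankLt of Defs for rectangular matrices; on Adj n they agree definitionally.
module _ {m d : ℕ} where

  Independent : (Fin m → Fin d → Bool) → Subset d → Subset m → Set
  Independent w C Q = (P : Subset m) → P ⊆ Q → Nonempty P → ∃ λ c → c ∈ C × rowSum P w c ≡ true

  Rank< : (Fin m → Fin d → Bool) → Subset m → Subset d → ℕ → Set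
  Rank< w R C k = (Q : Subset m) → Q ⊆ R → ∣ Q ∣ ≡ k → ¬ Independent w C Q

  InSpan : (Fin m → Fin d → Bool) → Subset d → Subset m → (Fin d → Bool) → Set
  InSpan w C B v = ∃ λ β → β ⊆ B × (∀ c → lookup C c ≡ true → v c ≡ rowSum β w c)

  SpanningFamily : (Fin m → Fin d → Bool) → Subset d → Subset m → Subset m → (Fin m → Fin d → Bool) → Set
  SpanningFamily w C B Q u = Σ (Fin m → Subset m) λ γ →
    (∀ y → lookup Q y ≡ true → γ y ⊆ B) ×
    (∀ y → lookup Q y ≡ true → ∀ c → lookup C c ≡ true → u y c ≡ rowSum (γ y) w c)

comb : ∀ {m} → (Fin m → Subset m) → Subset m → Subset m
comb γ P = tabulate (λ z → parity (λ y → lookup P y ∧ lookup (γ y) z))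

module _ {m d : ℕ} {w : Fin m → Fin d → Bool} {C : Subset d} where

  independent-⊆ : ∀ {Q Q′} → Q′ ⊆ Q → Independent w C Q → Independent w C Q′
  independent-⊆ Q′⊆Q ind P P⊆Q′ ne = ind P (λ z → Q′⊆Q (P⊆Q′ z)) ne

  independent-cols : ∀ {Q C′} → C ⊆ C′ → Independent w C Q → Independent w C′ Q
  independent-cols C⊆C′ ind P P⊆Q ne = let (c , c∈C , e) = ind P P⊆Q ne in c , C⊆C′ c∈C , e

  independent-∅ : Independent w C ∅
  independent-∅ P P⊆⊥ (i , i∈P) = ⊥-elim (∉⊥ (P⊆⊥ i∈P))

  choose-spanning-family : ∀ {B Q : Subset m} {u : Fin m → Fin d → Bool} →
    (∀ y → lookup Q y ≡ true → InSpan w C B (u y)) → SpanningFamily w C B Q u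
  choose-spanning-family {B} {Q} {u} h = γ , (λ y t → proj₁ (spec y t)) , (λ y t → proj₂ (spec y t))
    where
    pick : ∀ y b → lookup Q y ≡ b → Subset m
    pick y true  e = proj₁ (h y e)
    pick y false e = ∅
    γ : Fin m → Subset m
    γ y = pick y (lookup Q y) refl
    spec′ : ∀ y b (e : lookup Q y ≡ b) → lookup Q y ≡ true →
            (pick y b e ⊆ B) × (∀ c → lookup C c ≡ true → u y c ≡ rowSum (pick y b e) w c)
    spec′ y true  e _ = proj₂ (h y e)
    spec′ y false e t = ⊥-elim (false≢true (trans (sym e) t))
    spec : ∀ y → lookup Q y ≡ true → (γ y ⊆ B) × (∀ c → lookup C c ≡ true → u y c ≡ rowSum (γ y) w c)
    spec y = spec′ y (lookup Q y) refl

  comb-⊆ : ∀ {B Q : Subset m} (γ : Fin m → Subset m) → (∀ y → lookup Q y ≡ true → γ y ⊆ B) →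
    ∀ P → P ⊆ Q → comb γ P ⊆ B
  comb-⊆ γ γ⊆B P P⊆Q = ⊆-intro λ z e →
    let (y , eyz) = parity≡true⇒∃ (λ y → lookup P y ∧ lookup (γ y) z) (trans (sym (lookup∘tabulate _ z)) e)
    in ⊆-elim (γ⊆B y (⊆-elim P⊆Q y (∧-conicalˡ _ _ eyz))) z (∧-conicalʳ _ _ eyz)

  rowSum-comb : ∀ {Q : Subset m} (γ : Fin m → Subset m) (u : Fin m → Fin d → Bool) →
    (∀ y → lookup Q y ≡ true → ∀ c → lookup C c ≡ true → u y c ≡ rowSum (γ y) w c) →
    ∀ P → P ⊆ Q → ∀ c → lookup C c ≡ true → rowSum P u c ≡ rowSum (comb γ P) w c
  rowSum-comb {Q} γ u hu P P⊆Q c c∈C = sym (begin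
    rowSum (comb γ P) w c
      ≡⟨ parity-cong (λ z → trans (cong (_∧ w z c) (lookup∘tabulate _ z))
                                  (sym (parity-∧ʳ (w z c) (λ y → lookup P y ∧ lookup (γ y) z)))) ⟩
    parity (λ z → parity (λ y → (lookup P y ∧ lookup (γ y) z) ∧ w z c))
      ≡⟨ parity-swap (λ y z → (lookup P y ∧ lookup (γ y) z) ∧ w z c) ⟩
    parity (λ y → parity (λ z → (lookup P y ∧ lookup (γ y) z) ∧ w z c))
      ≡⟨ parity-cong row ⟩
    rowSum P u c ∎)
    where
    open ≡-Reasoning
    row : ∀ y → parity (λ z → (lookup P y ∧ lookup (γ y) z) ∧ w z c) ≡ lookup P y ∧ u y c
    row y with lookup P y in e
    ... | true  = sym (hu y (⊆-elim P⊆Q y e) c c∈C)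
    ... | false = parity-false {m}

  -- P ↦ comb γ P is injective on the subsets of the independent set Q.
  independent-card≤span : ∀ {w₁ : Fin m → Fin d → Bool} {B Q : Subset m} →
    Independent w₁ C Q → SpanningFamily w C B Q w₁ → ∣ Q ∣ ≤ ∣ B ∣
  independent-card≤span {w₁} {B} {Q} ind (γ , γ⊆B , γ-spans) =
    card-≤-by-injection Q B (comb γ) (comb-⊆ γ γ⊆B) comb-injective
    where
    comb-injective : ∀ P P′ → P ⊆ Q → P′ ⊆ Q → comb γ P ≡ comb γ P′ → P ≡ P′
    comb-injective P P′ P⊆Q P′⊆Q e = lookup-ext λ i → xor≡false⇒≡ (trans (sym (lookup-⊕ P P′ i)) (D-empty i))
      where
      D : Subset m
      D = P ⊕ P′
      D-null : ∀ c → lookup C c ≡ true → rowSum D w₁ c ≡ false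
      D-null c c∈C = begin
        rowSum D w₁ c                                      ≡⟨ rowSum-⊕ P P′ w₁ c ⟩
        rowSum P w₁ c xor rowSum P′ w₁ c                   ≡⟨ cong₂ _xor_ (rowSum-comb γ w₁ γ-spans P P⊆Q c c∈C)
                                                                          (rowSum-comb γ w₁ γ-spans P′ P′⊆Q c c∈C) ⟩
        rowSum (comb γ P) w c xor rowSum (comb γ P′) w c   ≡⟨ cong (λ t → rowSum (comb γ P) w c xor rowSum t w c) e ⟨
        rowSum (comb γ P) w c xor rowSum (comb γ P) w c    ≡⟨ xor-same (rowSum (comb γ P) w c) ⟩
        false                                              ∎
        where open ≡-Reasoning
      D-empty : ∀ i → lookup D i ≡ false
      D-empty i = ¬-not λ t →
        let (c , c∈C , s) = ind D (⊕-least P⊆Q P′⊆Q) (i , lookup⇒∈ t)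
        in false≢true (trans (sym (D-null c (∈⇒lookup c∈C))) s)

module _ {m d : ℕ} (w : Fin m → Fin d → Bool) (C : Subset d) where

  private
    Witnessed : Subset m → Set
    Witnessed P = ∃ λ c → c ∈ C × rowSum P w c ≡ true

    witnessed? : ∀ P → Dec (Witnessed P)
    witnessed? P = any? λ c → c ∈? C ×-dec rowSum P w c ≟ᵇ true

    dependency? : ∀ Q → Dec (∃ λ P → P ⊆ Q × Nonempty P × ¬ Witnessed P)
    dependency? Q = anySubset? λ P → P ⊆? Q ×-dec nonempty? P ×-dec ¬? (witnessed? P)

    no-dependency⇒independent : ∀ {Q} → ¬ (∃ λ P → P ⊆ Q × Nonempty P × ¬ Witnessed P) → Independent w C Q
    no-dependency⇒independent ¬dep P P⊆Q ne = decidable-stable (witnessed? P) λ ¬w → ¬dep (P , P⊆Q , ne , ¬w)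

  independent? : ∀ Q → Dec (Independent w C Q)
  independent? Q with dependency? Q
  ... | yes (P , P⊆Q , ne , ¬w) = no λ ind → ¬w (ind P P⊆Q ne)
  ... | no ¬dep                 = yes (no-dependency⇒independent ¬dep)

  ¬independent⇒null-combination : ∀ Q → ¬ Independent w C Q →
    ∃ λ P → P ⊆ Q × Nonempty P × (∀ c → lookup C c ≡ true → rowSum P w c ≡ false)
  ¬independent⇒null-combination Q ¬ind with dependency? Q
  ... | yes (P , P⊆Q , ne , ¬w) = P , P⊆Q , ne , λ c c∈C → ¬-not λ t → ¬w (c , lookup⇒∈ c∈C , t)
  ... | no ¬dep                 = ⊥-elim (¬ind (no-dependency⇒independent ¬dep))

  private
    Large : Subset m → ℕ → Set
    Large R k = ∃ λ Q → Q ⊆ R × ∣ Q ∣ ≡ k × Independent w C Q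

    large? : ∀ R k → Dec (Large R k)
    large? R k = anySubset? λ Q → Q ⊆? R ×-dec ∣ Q ∣ ≟ℕ k ×-dec independent? Q

    ¬large⇒rank< : ∀ {R k} → ¬ Large R k → Rank< w R C k
    ¬large⇒rank< ¬large Q Q⊆R eQ ind = ¬large (Q , Q⊆R , eQ , ind)

  rank<? : ∀ R k → Dec (Rank< w R C k)
  rank<? R k = map′ ¬large⇒rank< (λ r (Q , Q⊆R , eQ , ind) → r Q Q⊆R eQ ind) (¬? (large? R k))

  ¬rank<⇒independent : ∀ R k → ¬ Rank< w R C k → ∃ λ Q → Q ⊆ R × ∣ Q ∣ ≡ k × Independent w C Q
  ¬rank<⇒independent R k ¬r = decidable-stable (large? R k) (λ ¬large → ¬r (¬large⇒rank< ¬large))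

  dependent-extension⇒span : ∀ {B y} → Independent w C B → ¬ Independent w C (B ∪ ⁅ y ⁆) → InSpan w C B (w y)
  dependent-extension⇒span {B} {y} indB ¬ind
    with P , P⊆ , ne , null ← ¬independent⇒null-combination (B ∪ ⁅ y ⁆) ¬ind =
    P ⊕ ⁅ y ⁆ , ⊆-intro β⊆B , λ c c∈C → sym (begin
      rowSum (P ⊕ ⁅ y ⁆) w c           ≡⟨ rowSum-⊕ P ⁅ y ⁆ w c ⟩
      rowSum P w c xor rowSum ⁅ y ⁆ w c ≡⟨ cong₂ _xor_ (null c c∈C) (rowSum-⁅⁆ y w c) ⟩
      w y c                            ∎)
    where
    open ≡-Reasoning
    other⇒∈B : ∀ {x} → x ∈ P → x ≢ y → x ∈ B
    other⇒∈B x∈P x≢y = [ id , (λ x∈y → ⊥-elim (x≢y (x∈⁅y⁆⇒x≡y y x∈y))) ]′ (x∈p∪q⁻ B ⁅ y ⁆ (P⊆ x∈P))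
    y∈P : y ∈ P
    y∈P = decidable-stable (y ∈? P) λ y∉P →
      let (c , c∈C , s) = indB P (λ x∈P → other⇒∈B x∈P λ { refl → y∉P x∈P }) ne
      in false≢true (trans (sym (null c (∈⇒lookup c∈C))) s)
    β⊆B : ∀ x → lookup (P ⊕ ⁅ y ⁆) x ≡ true → lookup B x ≡ true
    β⊆B x e with x ≟ y
    ... | yes refl = ⊥-elim (false≢true (trans (sym (trans (lookup-⊕ P ⁅ y ⁆ y)
                                               (cong₂ _xor_ (∈⇒lookup y∈P) (trans (lookup-⁅⁆ y y) (δ-refl y))))) e))
    ... | no x≢y = ∈⇒lookup (other⇒∈B (lookup⇒∈ (trans (sym (xor-identityʳ _))
                             (trans (cong (lookup P x xor_) (sym (trans (lookup-⁅⁆ y x) (δ-≢ x≢y))))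
                                    (trans (sym (lookup-⊕ P ⁅ y ⁆ x)) e)))) x≢y)

  span-mono : ∀ {B B′ v} → B ⊆ B′ → InSpan w C B v → InSpan w C B′ v
  span-mono h (β , β⊆B , e) = β , ⊆-trans β⊆B h , e

  span-row : ∀ {B} y → lookup B y ≡ true → InSpan w C B (w y)
  span-row y e = ⁅ y ⁆ , ⁅⁆⊆ y e , λ c _ → sym (rowSum-⁅⁆ y w c)

  Basis : Subset m → Subset m → Set
  Basis S I = ∃ λ B → I ⊆ B × B ⊆ S × Independent w C B × (∀ x → lookup S x ≡ true → InSpan w C B (w x))

  extend-to-basis : ∀ S I → I ⊆ S → Independent w C I → Basis S I
  extend-to-basis S I I⊆S indI = go (allFin m) I ⊆-refl I⊆S indI (λ x _ → inj₁ (∈-allFin x))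
    where
    go : (L : List (Fin m)) (B : Subset m) → I ⊆ B → B ⊆ S → Independent w C B →
         (∀ x → lookup S x ≡ true → x List.∈ L ⊎ InSpan w C B (w x)) → Basis S I
    go [] B I⊆B B⊆S indB todo = B , I⊆B , B⊆S , indB , λ x x∈S → [ (λ ()) , id ]′ (todo x x∈S)
    go (y ∷ L) B I⊆B B⊆S indB todo with independent? (B ∪ ⁅ y ⁆) | y ∈? S
    ... | yes ind′ | yes y∈S =
      go L (B ∪ ⁅ y ⁆) (⊆-trans I⊆B (p⊆p∪q ⁅ y ⁆)) (∪-least B⊆S (⁅⁆⊆ y (∈⇒lookup y∈S))) ind′ λ x x∈S →
        case todo x x∈S of λ where
          (inj₁ (Any.here refl)) → inj₂ (span-row x (⊆-elim (q⊆p∪q B ⁅ x ⁆) x (∈⇒lookup (x∈⁅x⁆ x))))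
          (inj₁ (Any.there x∈L)) → inj₁ x∈L
          (inj₂ sp)              → inj₂ (span-mono (p⊆p∪q ⁅ y ⁆) sp)
    ... | _ | no y∉S = go L B I⊆B B⊆S indB λ x x∈S →
        case todo x x∈S of λ where
          (inj₁ (Any.here refl)) → ⊥-elim (y∉S (lookup⇒∈ x∈S))
          (inj₁ (Any.there x∈L)) → inj₁ x∈L
          (inj₂ sp)              → inj₂ sp
    ... | no ¬ind′ | yes _ = go L B I⊆B B⊆S indB λ x x∈S →
        case todo x x∈S of λ where
          (inj₁ (Any.here refl)) → inj₂ (dependent-extension⇒span indB ¬ind′)
          (inj₁ (Any.there x∈L)) → inj₁ x∈L
          (inj₂ sp)              → inj₂ sp

subset-of-size : ∀ {m} k (Q : Subset m) → k ≤ ∣ Q ∣ → ∃ λ Q′ → Q′ ⊆ Q × ∣ Q′ ∣ ≡ k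
subset-of-size {m} zero Q _ = ∅ , ⊥⊆ , ∣⊥∣≡0 m
subset-of-size (suc k) (true ∷ Q) (s≤s h) =
  let (Q′ , Q′⊆Q , e) = subset-of-size k Q h in true ∷ Q′ , s⊆s Q′⊆Q , cong suc e
subset-of-size (suc k) (false ∷ Q) h =
  let (Q′ , Q′⊆Q , e) = subset-of-size (suc k) Q h in false ∷ Q′ , s⊆s Q′⊆Q , e

∣p∪q∣+∣p∩q∣≡∣p∣+∣q∣ : ∀ {n} (p q : Subset n) → ∣ p ∪ q ∣ + ∣ p ∩ q ∣ ≡ ∣ p ∣ + ∣ q ∣
∣p∪q∣+∣p∩q∣≡∣p∣+∣q∣ []          []          = refl
∣p∪q∣+∣p∩q∣≡∣p∣+∣q∣ (true  ∷ p) (true  ∷ q) =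
  cong suc (trans (+-suc _ _) (trans (cong suc (∣p∪q∣+∣p∩q∣≡∣p∣+∣q∣ p q)) (sym (+-suc _ _))))
∣p∪q∣+∣p∩q∣≡∣p∣+∣q∣ (true  ∷ p) (false ∷ q) = cong suc (∣p∪q∣+∣p∩q∣≡∣p∣+∣q∣ p q)
∣p∪q∣+∣p∩q∣≡∣p∣+∣q∣ (false ∷ p) (true  ∷ q) = trans (cong suc (∣p∪q∣+∣p∩q∣≡∣p∣+∣q∣ p q)) (sym (+-suc _ _))
∣p∪q∣+∣p∩q∣≡∣p∣+∣q∣ (false ∷ p) (false ∷ q) = ∣p∪q∣+∣p∩q∣≡∣p∣+∣q∣ p q

∣p∣≤1+∣p─⁅y⁆∣ : ∀ {n} (p : Subset n) y → ∣ p ∣ ≤ suc ∣ p ─ ⁅ y ⁆ ∣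
∣p∣≤1+∣p─⁅y⁆∣ []          y       = z≤n
∣p∣≤1+∣p─⁅y⁆∣ (true  ∷ p) zero    = s≤s (≤-reflexive (cong ∣_∣ (sym (p─⊥≡p p))))
∣p∣≤1+∣p─⁅y⁆∣ (false ∷ p) zero    = m≤n⇒m≤1+n (≤-reflexive (cong ∣_∣ (sym (p─⊥≡p p))))
∣p∣≤1+∣p─⁅y⁆∣ (true  ∷ p) (suc y) = s≤s (∣p∣≤1+∣p─⁅y⁆∣ p y)
∣p∣≤1+∣p─⁅y⁆∣ (false ∷ p) (suc y) = ∣p∣≤1+∣p─⁅y⁆∣ p y

module _ {m d : ℕ} {C : Subset d} where

  span-transfer : ∀ {w₁ w₂ : Fin m → Fin d → Bool} {R₁ R₂ Q : Subset m} →
    (∀ x → lookup R₁ x ≡ true → InSpan w₂ C R₂ (w₁ x)) → Q ⊆ R₁ → Independent w₁ C Q →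
    ∃ λ Q′ → Q′ ⊆ R₂ × ∣ Q′ ∣ ≡ ∣ Q ∣ × Independent w₂ C Q′
  span-transfer {w₁} {w₂} {R₁} {R₂} {Q} spans Q⊆R₁ indQ
    with B , _ , B⊆R₂ , indB , B-spans ← extend-to-basis w₂ C R₂ ∅ ⊥⊆ (independent-∅ {w = w₂} {C}) =
    let ∣Q∣≤∣B∣ = independent-card≤span {w = w₂} {C} indQ (choose-spanning-family {w = w₂} {C} {Q = Q} Q-in-span)
        (Q′ , Q′⊆B , e) = subset-of-size ∣ Q ∣ B ∣Q∣≤∣B∣
    in Q′ , ⊆-trans Q′⊆B B⊆R₂ , e , independent-⊆ {w = w₂} {C} Q′⊆B indB
    where
    γ : SpanningFamily w₂ C B R₂ w₂
    γ = choose-spanning-family {w = w₂} {C} {B} {R₂} B-spans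
    Q-in-span : ∀ y → lookup Q y ≡ true → InSpan w₂ C B (w₁ y)
    Q-in-span y y∈Q with β , β⊆R₂ , e ← spans y (⊆-elim Q⊆R₁ y y∈Q) =
      comb (proj₁ γ) β , comb-⊆ {w = w₂} {C} {Q = R₂} (proj₁ γ) (proj₁ (proj₂ γ)) β β⊆R₂ ,
      λ c c∈C → trans (e c c∈C) (rowSum-comb {w = w₂} {C} {Q = R₂} (proj₁ γ) w₂ (proj₂ (proj₂ γ)) β β⊆R₂ c c∈C)

  Rank<-span : ∀ {w₁ w₂ : Fin m → Fin d → Bool} {R₁ R₂ : Subset m} {k} →
    (∀ x → lookup R₁ x ≡ true → InSpan w₂ C R₂ (w₁ x)) → Rank< w₂ R₂ C k → Rank< w₁ R₁ C k
  Rank<-span spans r Q Q⊆R₁ eQ indQ =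
    let (Q′ , Q′⊆R₂ , e , indQ′) = span-transfer spans Q⊆R₁ indQ in r Q′ Q′⊆R₂ (trans e eQ) indQ′

  independent-card<rank : ∀ {w : Fin m → Fin d → Bool} {R B : Subset m} {k} →
    Rank< w R C k → B ⊆ R → Independent w C B → ∣ B ∣ < k
  independent-card<rank {w} {B = B} {k} r B⊆R indB with k ≤? ∣ B ∣
  ... | no  k≰ = ≰⇒> k≰
  ... | yes k≤ = let (Q , Q⊆B , e) = subset-of-size k B k≤
                 in ⊥-elim (r Q (⊆-trans Q⊆B B⊆R) e (independent-⊆ {w = w} {C} Q⊆B indB))

  Rank<-mono : ∀ {w : Fin m → Fin d → Bool} {R : Subset m} {k l} → k ≤ l → Rank< w R C k → Rank< w R C l
  Rank<-mono k≤l r Q Q⊆R eQ indQ =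
    <-irrefl refl (≤-trans (independent-card<rank r Q⊆R indQ) (≤-trans k≤l (≤-reflexive (sym eQ))))

  -- With bases B₁ ⊇ I of R₁ and B₂ ⊇ I of R₂, the rows of J lie in the span of B₁ ∪ B₂.
  rows-submodular : ∀ {w : Fin m → Fin d → Bool} {R₁ R₂ I J : Subset m} {k₁ k₂} →
    Rank< w R₁ C k₁ → Rank< w R₂ C k₂ →
    I ⊆ R₁ ∩ R₂ → Independent w C I → J ⊆ R₁ ∪ R₂ → Independent w C J → 2 + (∣ I ∣ + ∣ J ∣) ≤ k₁ + k₂
  rows-submodular {w} {R₁} {R₂} {I} {J} {k₁} {k₂} r₁ r₂ I⊆ indI J⊆ indJ
    with B₁ , I⊆B₁ , B₁⊆ , indB₁ , spans₁ ← extend-to-basis w C R₁ I (⊆-trans I⊆ (p∩q⊆p R₁ R₂)) indI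
       | B₂ , I⊆B₂ , B₂⊆ , indB₂ , spans₂ ← extend-to-basis w C R₂ I (⊆-trans I⊆ (p∩q⊆q R₁ R₂)) indI =
    begin
      2 + (∣ I ∣ + ∣ J ∣)                 ≤⟨ s≤s (s≤s (+-mono-≤ ∣I∣≤ ∣J∣≤)) ⟩
      2 + (∣ B₁ ∩ B₂ ∣ + ∣ B₁ ∪ B₂ ∣)     ≡⟨ cong (2 +_) (+-comm ∣ B₁ ∩ B₂ ∣ ∣ B₁ ∪ B₂ ∣) ⟩
      2 + (∣ B₁ ∪ B₂ ∣ + ∣ B₁ ∩ B₂ ∣)     ≡⟨ cong (2 +_) (∣p∪q∣+∣p∩q∣≡∣p∣+∣q∣ B₁ B₂) ⟩
      2 + (∣ B₁ ∣ + ∣ B₂ ∣)               ≡⟨ cong suc (+-suc ∣ B₁ ∣ ∣ B₂ ∣) ⟨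
      suc ∣ B₁ ∣ + suc ∣ B₂ ∣             ≤⟨ +-mono-≤ (independent-card<rank r₁ B₁⊆ indB₁)
                                                       (independent-card<rank r₂ B₂⊆ indB₂) ⟩
      k₁ + k₂                             ∎
    where
    open ≤-Reasoning
    J-in-span : ∀ y → lookup J y ≡ true → InSpan w C (B₁ ∪ B₂) (w y)
    J-in-span y y∈J = [ (λ y∈R₁ → span-mono w C (p⊆p∪q B₂) (spans₁ y (∈⇒lookup y∈R₁)))
                      , (λ y∈R₂ → span-mono w C (q⊆p∪q B₁ B₂) (spans₂ y (∈⇒lookup y∈R₂))) ]′
                      (x∈p∪q⁻ R₁ R₂ (J⊆ (lookup⇒∈ y∈J)))
    ∣J∣≤ : ∣ J ∣ ≤ ∣ B₁ ∪ B₂ ∣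
    ∣J∣≤ = independent-card≤span {w = w} {C} indJ (choose-spanning-family {w = w} {C} {Q = J} J-in-span)
    ∣I∣≤ : ∣ I ∣ ≤ ∣ B₁ ∩ B₂ ∣
    ∣I∣≤ = p⊆q⇒∣p∣≤∣q∣ (∩-greatest I⊆B₁ I⊆B₂)

-- The rows of M followed by the unit vectors: rank (augment M)[R ++ ∁ C, ⊤] = rank M[R, C] + ∣ ∁ C ∣,
-- which reduces submodularity in the columns to submodularity in the rows.
augment : ∀ {a n} → (Fin a → Fin n → Bool) → Fin (a + n) → Fin n → Bool
augment {a} M i = [ M , δ ]′ (splitAt a i)

lookup-++-↑ˡ : ∀ {a n} (P : Subset a) (F : Subset n) x → lookup (P ++ F) (x ↑ˡ n) ≡ lookup P x
lookup-++-↑ˡ (p ∷ P) F zero    = refl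
lookup-++-↑ˡ (p ∷ P) F (suc x) = lookup-++-↑ˡ P F x

lookup-++-↑ʳ : ∀ {a n} (P : Subset a) (F : Subset n) j → lookup (P ++ F) (a ↑ʳ j) ≡ lookup F j
lookup-++-↑ʳ []      F j = refl
lookup-++-↑ʳ (p ∷ P) F j = lookup-++-↑ʳ P F j

∣++∣ : ∀ {a n} (P : Subset a) (F : Subset n) → ∣ P ++ F ∣ ≡ ∣ P ∣ + ∣ F ∣
∣++∣ []          F = refl
∣++∣ (true  ∷ P) F = cong suc (∣++∣ P F)
∣++∣ (false ∷ P) F = ∣++∣ P F

parity-+ : ∀ a {n} (f : Fin (a + n) → Bool) → parity f ≡ parity (λ x → f (x ↑ˡ n)) xor parity (λ j → f (a ↑ʳ j))
parity-+ zero    f = refl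
parity-+ (suc a) f = trans (cong (f zero xor_) (parity-+ a (λ i → f (suc i)))) (sym (xor-assoc (f zero) _ _))

nonempty-++⁻ : ∀ {a n} (P : Subset a) (F : Subset n) → Nonempty (P ++ F) → ¬ Nonempty P → Nonempty F
nonempty-++⁻ []      F ne               ¬neP = ne
nonempty-++⁻ (p ∷ P) F (zero , here)    ¬neP = ⊥-elim (¬neP (zero , here))
nonempty-++⁻ (p ∷ P) F (suc i , there i∈) ¬neP = nonempty-++⁻ P F (i , i∈) λ (x , x∈) → ¬neP (suc x , there x∈)

module _ {a n : ℕ} where

  augment-↑ˡ : ∀ (M : Fin a → Fin n → Bool) x c → augment M (x ↑ˡ n) c ≡ M x c
  augment-↑ˡ M x c = cong (λ s → [ M , δ ]′ s c) (splitAt-↑ˡ a x n)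

  augment-↑ʳ : ∀ (M : Fin a → Fin n → Bool) j c → augment M (a ↑ʳ j) c ≡ δ j c
  augment-↑ʳ M j c = cong (λ s → [ M , δ ]′ s c) (splitAt-↑ʳ a n j)

  ++-⊆ : ∀ {P P′ : Subset a} {F F′ : Subset n} → P ⊆ P′ → F ⊆ F′ → P ++ F ⊆ P′ ++ F′
  ++-⊆ {P} {P′} {F} {F′} P⊆ F⊆ = ⊆-intro λ i → mem i (splitAt a i) (sym (join-splitAt a n i))
    where
    mem : ∀ i s → i ≡ join a n s → lookup (P ++ F) i ≡ true → lookup (P′ ++ F′) i ≡ true
    mem _ (inj₁ x) refl e = trans (lookup-++-↑ˡ P′ F′ x) (⊆-elim P⊆ x (trans (sym (lookup-++-↑ˡ P F x)) e))
    mem _ (inj₂ j) refl e = trans (lookup-++-↑ʳ P′ F′ j) (⊆-elim F⊆ j (trans (sym (lookup-++-↑ʳ P F j)) e))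

  ++-⊆⁻ˡ : ∀ (P P′ : Subset a) (F F′ : Subset n) → P ++ F ⊆ P′ ++ F′ → P ⊆ P′
  ++-⊆⁻ˡ P P′ F F′ h = ⊆-intro λ x e →
    trans (sym (lookup-++-↑ˡ P′ F′ x)) (⊆-elim h (x ↑ˡ n) (trans (lookup-++-↑ˡ P F x) e))

  ++-⊆⁻ʳ : ∀ (P P′ : Subset a) (F F′ : Subset n) → P ++ F ⊆ P′ ++ F′ → F ⊆ F′
  ++-⊆⁻ʳ P P′ F F′ h = ⊆-intro λ j e →
    trans (sym (lookup-++-↑ʳ P′ F′ j)) (⊆-elim h (a ↑ʳ j) (trans (lookup-++-↑ʳ P F j) e))

  rowSum-augment : ∀ (M : Fin a → Fin n → Bool) (P : Subset a) (F : Subset n) c →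
    rowSum (P ++ F) (augment M) c ≡ rowSum P M c xor lookup F c
  rowSum-augment M P F c = trans (parity-+ a (λ i → lookup (P ++ F) i ∧ augment M i c))
    (cong₂ _xor_ (parity-cong (λ x → cong₂ _∧_ (lookup-++-↑ˡ P F x) (augment-↑ˡ M x c)))
                 (trans (parity-cong (λ j → trans (cong₂ _∧_ (lookup-++-↑ʳ P F j) (augment-↑ʳ M j c))
                                                  (∧-comm _ (δ j c))))
                        (parity-δ c (lookup F))))

  augment-independent : ∀ {M : Fin a → Fin n → Bool} {C : Subset n} {Q : Subset a} →
    Independent M C Q → Independent (augment M) ⊤ (Q ++ ∁ C)
  augment-independent {M} {C} {Q} indQ P′ P′⊆ (i , i∈P′) with Data.Vec.splitAt a P′
  ... | P , F , refl with nonempty? P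
  ...   | yes neP = let (c , c∈C , e) = indQ P (++-⊆⁻ˡ P Q F (∁ C) P′⊆) neP in
    c , ∈⊤ , trans (rowSum-augment M P F c) (trans (cong₂ _xor_ e (F-outside-C c∈C)) refl)
    where
    F-outside-C : ∀ {c} → c ∈ C → lookup F c ≡ false
    F-outside-C c∈C = ¬-not λ t → x∈p⇒x∉∁p c∈C (++-⊆⁻ʳ P Q F (∁ C) P′⊆ (lookup⇒∈ t))
  ...   | no ¬neP = case nonempty? F of λ where
      (yes (j , j∈F)) → j , ∈⊤ , trans (rowSum-augment M P F j)
                                       (cong₂ _xor_ (P-null j) (∈⇒lookup j∈F))
      (no ¬neF) → ⊥-elim (¬neF (nonempty-++⁻ P F (i , i∈P′) ¬neP))
    where
    P-null : ∀ j → rowSum P M j ≡ false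
    P-null j = trans (parity-cong (λ x → cong (_∧ M x j) (¬-not λ t → ¬neP (x , lookup⇒∈ t)))) (parity-false {a})

  augment-independent⁻ : ∀ {M : Fin a → Fin n → Bool} {C : Subset n} {P₀ : Subset a} →
    Independent (augment M) ⊤ (P₀ ++ ∁ C) → Independent M C P₀
  augment-independent⁻ {M} {C} {P₀} ind P P⊆P₀ (x , x∈P) =
    decidable-stable (any? λ c → c ∈? C ×-dec rowSum P M c ≟ᵇ true) λ ¬witness →
      let (c , _ , e) = ind (P ++ F) (++-⊆ P⊆P₀ F⊆∁C) (x ↑ˡ n , lookup⇒∈ (trans (lookup-++-↑ˡ P F x) (∈⇒lookup x∈P)))
      in false≢true (trans (sym (null ¬witness c)) e)
    where
    -- the unit vectors outside C that cancel the columns of ∑ P outside C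
    F : Subset n
    F = tabulate λ j → not (lookup C j) ∧ rowSum P M j
    F⊆∁C : F ⊆ ∁ C
    F⊆∁C = ⊆-intro λ j e → trans (lookup-∁ C j) (∧-conicalˡ _ _ (trans (sym (lookup∘tabulate _ j)) e))
    null : ¬ (∃ λ c → c ∈ C × rowSum P M c ≡ true) → ∀ c → rowSum (P ++ F) (augment M) c ≡ false
    null ¬witness c with lookup C c in c∈C?
    ... | true  = trans (rowSum-augment M P F c)
                        (cong₂ _xor_ (¬-not λ t → ¬witness (c , lookup⇒∈ c∈C? , t))
                                     (trans (lookup∘tabulate _ c) (cong (λ t → not t ∧ rowSum P M c) c∈C?)))
    ... | false = trans (rowSum-augment M P F c)
                        (trans (cong (rowSum P M c xor_) (trans (lookup∘tabulate _ c)
                                                                (cong (λ t → not t ∧ rowSum P M c) c∈C?)))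
                               (xor-same (rowSum P M c)))

  augment-Rank< : ∀ {M : Fin a → Fin n → Bool} {R : Subset a} {C : Subset n} {k} →
    Rank< M R C k → Rank< (augment M) (R ++ ∁ C) ⊤ (k + ∣ ∁ C ∣)
  augment-Rank< {M} {R} {C} {k} r Z Z⊆ eZ indZ
    with B , ∁C⊆B , B⊆ , indB , B-spans ←
           extend-to-basis (augment M) ⊤ (R ++ ∁ C) (∅ ++ ∁ C) (++-⊆ ⊥⊆ ⊆-refl)
                           (augment-independent (independent-∅ {w = M} {C}))
    with B₁ , B₂ , refl ← Data.Vec.splitAt a B =
    let (Q , Q⊆B₁ , eQ) = subset-of-size k B₁ k≤∣B₁∣
    in r Q (⊆-trans Q⊆B₁ (++-⊆⁻ˡ B₁ R B₂ (∁ C) B⊆)) eQ (independent-⊆ {w = M} {C} Q⊆B₁ (augment-independent⁻ indB₁))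
    where
    B₂≡∁C : B₂ ≡ ∁ C
    B₂≡∁C = ⊆-antisym (++-⊆⁻ʳ B₁ R B₂ (∁ C) B⊆) (++-⊆⁻ʳ ∅ B₁ (∁ C) B₂ ∁C⊆B)
    indB₁ : Independent (augment M) ⊤ (B₁ ++ ∁ C)
    indB₁ = subst (λ t → Independent (augment M) ⊤ (B₁ ++ t)) B₂≡∁C indB
    ∣Z∣≤∣B∣ : ∣ Z ∣ ≤ ∣ B₁ ++ B₂ ∣
    ∣Z∣≤∣B∣ = independent-card≤span {w = augment M} {⊤} indZ
                (choose-spanning-family {w = augment M} {⊤} {Q = Z} λ y y∈Z → B-spans y (⊆-elim Z⊆ y y∈Z))
    k≤∣B₁∣ : k ≤ ∣ B₁ ∣
    k≤∣B₁∣ = +-cancelʳ-≤ (∣ ∁ C ∣) k (∣ B₁ ∣) (begin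
      k + ∣ ∁ C ∣     ≡⟨ sym eZ ⟩
      ∣ Z ∣           ≤⟨ ∣Z∣≤∣B∣ ⟩
      ∣ B₁ ++ B₂ ∣    ≡⟨ trans (∣++∣ B₁ B₂) (cong (λ t → ∣ B₁ ∣ + ∣ t ∣) B₂≡∁C) ⟩
      ∣ B₁ ∣ + ∣ ∁ C ∣ ∎)
      where open ≤-Reasoning

  matrix-submodular : ∀ {M : Fin a → Fin n → Bool} {R₁ R₂ Q₁ Q₂ : Subset a} {C₁ C₂ : Subset n} {k₁ k₂} →
    Rank< M R₁ C₁ k₁ → Rank< M R₂ C₂ k₂ →
    Q₁ ⊆ R₁ ∩ R₂ → Independent M (C₁ ∪ C₂) Q₁ → Q₂ ⊆ R₁ ∪ R₂ → Independent M (C₁ ∩ C₂) Q₂ →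
    2 + (∣ Q₁ ∣ + ∣ Q₂ ∣) ≤ k₁ + k₂
  matrix-submodular {M} {R₁} {R₂} {Q₁} {Q₂} {C₁} {C₂} {k₁} {k₂} r₁ r₂ Q₁⊆ ind₁ Q₂⊆ ind₂ =
    +-cancelʳ-≤ (∣ ∁ C₁ ∣ + ∣ ∁ C₂ ∣) _ _ (begin
      2 + (∣ Q₁ ∣ + ∣ Q₂ ∣) + (∣ ∁ C₁ ∣ + ∣ ∁ C₂ ∣)   ≡⟨ cong (2 + (∣ Q₁ ∣ + ∣ Q₂ ∣) +_) (sym ∣U∣+∣V∣) ⟩
      2 + (∣ Q₁ ∣ + ∣ Q₂ ∣) + (∣ U ∣ + ∣ V ∣)         ≡⟨ cong (2 +_) (+-interchange (∣ Q₁ ∣) (∣ Q₂ ∣) (∣ U ∣) (∣ V ∣)) ⟩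
      2 + ((∣ Q₁ ∣ + ∣ U ∣) + (∣ Q₂ ∣ + ∣ V ∣))       ≡⟨ cong₂ (λ s t → 2 + (s + t)) (∣++∣ Q₁ U) (∣++∣ Q₂ V) ⟨
      2 + (∣ Q₁ ++ U ∣ + ∣ Q₂ ++ V ∣)               ≤⟨ rows-submodular (augment-Rank< r₁) (augment-Rank< r₂)
                                                                     I⊆ (augment-independent ind₁)
                                                                     J⊆ (augment-independent ind₂) ⟩
      (k₁ + ∣ ∁ C₁ ∣) + (k₂ + ∣ ∁ C₂ ∣)             ≡⟨ +-interchange k₁ (∣ ∁ C₁ ∣) k₂ (∣ ∁ C₂ ∣) ⟩
      (k₁ + k₂) + (∣ ∁ C₁ ∣ + ∣ ∁ C₂ ∣)             ∎)
    where
    open ≤-Reasoning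
    open BooleanAlgebraProperties (∪-∩-booleanAlgebra n) using (deMorgan₁; deMorgan₂)
    U V : Subset n
    U = ∁ (C₁ ∪ C₂)
    V = ∁ (C₁ ∩ C₂)
    U≡ : U ≡ ∁ C₁ ∩ ∁ C₂
    U≡ = deMorgan₂ C₁ C₂
    V≡ : V ≡ ∁ C₁ ∪ ∁ C₂
    V≡ = deMorgan₁ C₁ C₂
    ∣U∣+∣V∣ : ∣ U ∣ + ∣ V ∣ ≡ ∣ ∁ C₁ ∣ + ∣ ∁ C₂ ∣
    ∣U∣+∣V∣ = trans (cong₂ (λ s t → ∣ s ∣ + ∣ t ∣) U≡ V≡)
                    (trans (+-comm (∣ ∁ C₁ ∩ ∁ C₂ ∣) (∣ ∁ C₁ ∪ ∁ C₂ ∣)) (∣p∪q∣+∣p∩q∣≡∣p∣+∣q∣ (∁ C₁) (∁ C₂)))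
    I⊆ : Q₁ ++ U ⊆ (R₁ ++ ∁ C₁) ∩ (R₂ ++ ∁ C₂)
    I⊆ = ∩-greatest (++-⊆ (⊆-trans Q₁⊆ (p∩q⊆p R₁ R₂)) (subst (_⊆ ∁ C₁) (sym U≡) (p∩q⊆p (∁ C₁) (∁ C₂))))
                    (++-⊆ (⊆-trans Q₁⊆ (p∩q⊆q R₁ R₂)) (subst (_⊆ ∁ C₂) (sym U≡) (p∩q⊆q (∁ C₁) (∁ C₂))))
    J⊆ : Q₂ ++ V ⊆ (R₁ ++ ∁ C₁) ∪ (R₂ ++ ∁ C₂)
    J⊆ = subst (Q₂ ++ V ⊆_) (sym (zipWith-++ _∨_ R₁ (∁ C₁) R₂ (∁ C₂))) (++-⊆ Q₂⊆ (⊆-reflexive V≡))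

data SetExpr : Set where
  ‵X ‵Y ‵v ‵⊤ ‵∅ : SetExpr
  ‵∁            : SetExpr → SetExpr
  _‵∩_ _‵∪_ _‵─_ : SetExpr → SetExpr → SetExpr

infixr 7 _‵∩_
infixr 6 _‵∪_ _‵─_

‵W : SetExpr
‵W = ‵∁ ‵v

truth : SetExpr → Bool → Bool → Bool → Bool
truth ‵X        a b e = a
truth ‵Y        a b e = b
truth ‵v        a b e = e
truth ‵⊤        a b e = true
truth ‵∅        a b e = false
truth (‵∁ s)    a b e = not (truth s a b e)
truth (s ‵∩ t)  a b e = truth s a b e ∧ truth t a b e
truth (s ‵∪ t)  a b e = truth s a b e ∨ truth t a b e
truth (s ‵─ t)  a b e = truth s a b e ∧ not (truth t a b e)

-- the rows of the truth table that can occur when X and Y avoid v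
OnConsistentRows : (Bool → Bool → Bool → Bool) → Set
OnConsistentRows f =
  Bool.T (f true true false) × Bool.T (f true false false) × Bool.T (f false true false) ×
  Bool.T (f false false false) × Bool.T (f false false true)

onConsistentRows-sound : ∀ f → OnConsistentRows f →
  ∀ a b e → (a ≡ true → e ≡ false) → (b ≡ true → e ≡ false) → Bool.T (f a b e)
onConsistentRows-sound f _                   true  _     true  a⇒ _  with () ← a⇒ refl
onConsistentRows-sound f _                   false true  true  _  b⇒ with () ← b⇒ refl
onConsistentRows-sound f (r , _)             true  true  false _  _  = r
onConsistentRows-sound f (_ , r , _)         true  false false _  _  = r
onConsistentRows-sound f (_ , _ , r , _)     false true  false _  _  = r
onConsistentRows-sound f (_ , _ , _ , r , _) false false false _  _  = r
onConsistentRows-sound f (_ , _ , _ , _ , r) false false true  _  _  = r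

_⇒ᵇ_ : Bool → Bool → Bool
a ⇒ᵇ b = not a ∨ b

_⇔ᵇ_ : Bool → Bool → Bool
a ⇔ᵇ b = not (a xor b)

⇒ᵇ-sound : ∀ {a b} → Bool.T (a ⇒ᵇ b) → a ≡ true → b ≡ true
⇒ᵇ-sound {true} {true} _ refl = refl

⇔ᵇ-sound : ∀ {a b} → Bool.T (a ⇔ᵇ b) → a ≡ b
⇔ᵇ-sound {true}  {true}  _ = refl
⇔ᵇ-sound {false} {false} _ = refl

module SetExprSemantics {n} (X Y : Subset n) (v : Fin n) where

  ⟦_⟧ : SetExpr → Subset n
  ⟦ ‵X ⟧     = X
  ⟦ ‵Y ⟧     = Y
  ⟦ ‵v ⟧     = ⁅ v ⁆
  ⟦ ‵⊤ ⟧     = ⊤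
  ⟦ ‵∅ ⟧     = ∅
  ⟦ ‵∁ s ⟧   = ∁ ⟦ s ⟧
  ⟦ s ‵∩ t ⟧ = ⟦ s ⟧ ∩ ⟦ t ⟧
  ⟦ s ‵∪ t ⟧ = ⟦ s ⟧ ∪ ⟦ t ⟧
  ⟦ s ‵─ t ⟧ = ⟦ s ⟧ ─ ⟦ t ⟧

  lookup-⟦⟧ : ∀ s x → lookup ⟦ s ⟧ x ≡ truth s (lookup X x) (lookup Y x) (δ x v)
  lookup-⟦⟧ ‵X       x = refl
  lookup-⟦⟧ ‵Y       x = refl
  lookup-⟦⟧ ‵v       x = lookup-⁅⁆ v x
  lookup-⟦⟧ ‵⊤       x = lookup-⊤ x
  lookup-⟦⟧ ‵∅       x = lookup-∅ x
  lookup-⟦⟧ (‵∁ s)   x = trans (lookup-∁ ⟦ s ⟧ x) (cong not (lookup-⟦⟧ s x))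
  lookup-⟦⟧ (s ‵∩ t) x = trans (lookup-∩ ⟦ s ⟧ ⟦ t ⟧ x) (cong₂ _∧_ (lookup-⟦⟧ s x) (lookup-⟦⟧ t x))
  lookup-⟦⟧ (s ‵∪ t) x = trans (lookup-∪ ⟦ s ⟧ ⟦ t ⟧ x) (cong₂ _∨_ (lookup-⟦⟧ s x) (lookup-⟦⟧ t x))
  lookup-⟦⟧ (s ‵─ t) x = trans (lookup-─ ⟦ s ⟧ ⟦ t ⟧ x) (cong₂ (λ p q → p ∧ not q) (lookup-⟦⟧ s x) (lookup-⟦⟧ t x))

  module DecideUnder (X⊆W : X ⊆ ∁ ⁅ v ⁆) (Y⊆W : Y ⊆ ∁ ⁅ v ⁆) where

    private
      avoids-v : ∀ {Z} → Z ⊆ ∁ ⁅ v ⁆ → ∀ x → lookup Z x ≡ true → δ x v ≡ false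
      avoids-v Z⊆W x e = ¬-not λ t → x∈p⇒x∉∁p (lookup⇒∈ (trans (lookup-⁅⁆ v x) t)) (Z⊆W (lookup⇒∈ e))

      row-sound : ∀ f → OnConsistentRows f → ∀ x → Bool.T (f (lookup X x) (lookup Y x) (δ x v))
      row-sound f h x = onConsistentRows-sound f h _ _ _ (avoids-v X⊆W x) (avoids-v Y⊆W x)

    -- The implicit truth-table argument is solved by Agda whenever the table evaluates to ⊤.
    ⟦⟧-≡ : ∀ s t → {_ : OnConsistentRows (λ a b e → truth s a b e ⇔ᵇ truth t a b e)} → ⟦ s ⟧ ≡ ⟦ t ⟧
    ⟦⟧-≡ s t {h} = lookup-ext λ x →
      trans (lookup-⟦⟧ s x) (trans (⇔ᵇ-sound (row-sound (λ a b e → truth s a b e ⇔ᵇ truth t a b e) h x))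
                                   (sym (lookup-⟦⟧ t x)))

    ⟦⟧-⊆ : ∀ s t → {_ : OnConsistentRows (λ a b e → truth s a b e ⇒ᵇ truth t a b e)} → ⟦ s ⟧ ⊆ ⟦ t ⟧
    ⟦⟧-⊆ s t {h} = ⊆-intro λ x e →
      trans (lookup-⟦⟧ t x) (⇒ᵇ-sound (row-sound (λ a b e → truth s a b e ⇒ᵇ truth t a b e) h x)
                                      (trans (sym (lookup-⟦⟧ s x)) e))

InS? : ∀ {n} (H : Adj n) (W : Subset n) k X → Dec (InS H W k X)
InS? H W k X = X ⊆? W ×-dec rank<? H (W ─ X) X k

InS-mono : ∀ {n} (H : Adj n) {W : Subset n} Z {a b} → a ≤ b → InS H W a Z → InS H W b Z
InS-mono H Z a≤b (Z⊆W , r) = Z⊆W , Rank<-mono {w = H} a≤b r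

module _ {n} {W D Z₁ Z₂ : Subset n} where

  cover-by-complement : D ⊆ W → Z₁ ∩ W ⊆ D → (∀ x → x ∈ Z₁ ⊎ x ∈ Z₂) → D ∪ Z₂ ∩ W ∪ Z₂ ∩ W ≡ W
  cover-by-complement D⊆W Z₁W⊆D Z₁∪Z₂ = ⊆-antisym (∪-least D⊆W (∪-least (p∩q⊆q Z₂ W) (p∩q⊆q Z₂ W))) λ {x} x∈W →
    [ (λ x∈Z₁ → p⊆p∪q _ (Z₁W⊆D (x∈p∩q⁺ (x∈Z₁ , x∈W))))
    , (λ x∈Z₂ → q⊆p∪q D _ (p⊆p∪q _ (x∈p∩q⁺ (x∈Z₂ , x∈W)))) ]′ (Z₁∪Z₂ x)

-- If the trace of the complement of Z were in T₁, it would cover W together with D; so Z ∈ T,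
-- and both T₁ and T₂ contain its trace.
module InducingTangles {n k} {A H : Adj n} {W : Subset n} {T T₁ T₂ : Family n}
  (tT : IsTangle A ⊤ k T) (tT₁ : IsTangle H W k T₁) (i₁ : Induces A k W T₁ T) (i₂ : Induces A k W T₂ T)
  (D : Subset n) (T₁D : T₁ D ≡ true) (D⊆W : D ⊆ W) where

  private
    agree-below : ∀ Z₁ Z₂ → T Z₁ ≡ true ⊎ T Z₂ ≡ true → (∀ x → x ∈ Z₁ ⊎ x ∈ Z₂) →
      Z₁ ∩ W ⊆ D → T₁ (Z₁ ∩ W) ≡ true × T₂ (Z₁ ∩ W) ≡ true
    agree-below Z₁ Z₂ (inj₁ TZ₁) _     _      = proj₂ (proj₁ (i₁ Z₁) TZ₁) , proj₂ (proj₁ (i₂ Z₁) TZ₁)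
    agree-below Z₁ Z₂ (inj₂ TZ₂) Z₁∪Z₂ Z₁W⊆D =
      let T₁Z₂ = proj₂ (proj₁ (i₁ Z₂) TZ₂)
      in ⊥-elim (IsTangle.noCover tT₁ D (Z₂ ∩ W) (Z₂ ∩ W) T₁D T₁Z₂ T₁Z₂ (cover-by-complement D⊆W Z₁W⊆D Z₁∪Z₂))

  small-agree : ∀ Z → InS A ⊤ k Z → Z ∩ W ⊆ D → T₁ (Z ∩ W) ≡ true × T₂ (Z ∩ W) ≡ true
  small-agree Z Z∈S = agree-below Z (⊤ ─ Z) (IsTangle.oneOf tT Z Z∈S) λ x →
    case x ∈? Z of λ where
      (yes x∈Z) → inj₁ x∈Z
      (no x∉Z)  → inj₂ (x∈p∧x∉q⇒x∈p─q ∈⊤ x∉Z)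

  co-small-agree : ∀ Z → InS A ⊤ k Z → (⊤ ─ Z) ∩ W ⊆ D → T₁ ((⊤ ─ Z) ∩ W) ≡ true × T₂ ((⊤ ─ Z) ∩ W) ≡ true
  co-small-agree Z Z∈S = agree-below (⊤ ─ Z) Z ([ inj₂ , inj₁ ]′ (IsTangle.oneOf tT Z Z∈S)) λ x →
    case x ∈? Z of λ where
      (yes x∈Z) → inj₂ x∈Z
      (no x∉Z)  → inj₁ (x∈p∧x∉q⇒x∈p─q ∈⊤ x∉Z)

-- P m, …, S m say that four fixed sets are small (cut-rank < m) in G; k and l are the orders of
-- the two split tangles. ¬P-¬S, …, ¬Q-¬R′ come from submodularity, P-Q, …, Q-S from the tangle
-- axioms.
record Corners (P Q R S : ℕ → Set) (k l : ℕ) : Set where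
  field
    P? : ∀ m → Dec (P m)
    Q? : ∀ m → Dec (Q m)
    R? : ∀ m → Dec (R m)
    S? : ∀ m → Dec (S m)
    P-mono : ∀ {a b} → a ≤ b → P a → P b
    Q-mono : ∀ {a b} → a ≤ b → Q a → Q b
    R-mono : ∀ {a b} → a ≤ b → R a → R b
    ¬P-¬S  : ¬ P k → ¬ ¬ S l
    ¬P-¬S′ : ¬ P l → ¬ ¬ S k
    ¬Q-¬R  : ¬ Q k → ¬ ¬ R l
    ¬Q-¬R′ : ¬ Q l → ¬ ¬ R k
    P-Q    : P k → ¬ Q k
    R-S    : R k → ¬ S k
    P-R    : P l → ¬ R l
    Q-S    : Q l → ¬ S l

  swap : Corners P R Q S l k
  swap = record
    { P? = P? ; Q? = R? ; R? = Q? ; S? = S?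
    ; P-mono = P-mono ; Q-mono = R-mono ; R-mono = Q-mono
    ; ¬P-¬S = ¬P-¬S′ ; ¬P-¬S′ = ¬P-¬S
    ; ¬Q-¬R = λ ¬rl ¬qk → ¬Q-¬R ¬qk ¬rl ; ¬Q-¬R′ = λ ¬rk ¬ql → ¬Q-¬R′ ¬ql ¬rk
    ; P-Q = P-R ; R-S = Q-S ; P-R = P-Q ; Q-S = R-S
    }

  absurd-≤ : k ≤ l → ⊥
  absurd-≤ k≤l with P? k
  ... | yes pk = P-R (P-mono k≤l pk) (decidable-stable (R? l) (¬Q-¬R (P-Q pk)))
  ... | no ¬pk = R-S rk sk
    where
    sl : S l
    sl = decidable-stable (S? l) (¬P-¬S ¬pk)
    rl : R l
    rl = decidable-stable (R? l) (¬Q-¬R λ qk → Q-S (Q-mono k≤l qk) sl)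
    sk : S k
    sk = decidable-stable (S? k) (¬P-¬S′ λ pl → P-R pl rl)
    rk : R k
    rk = decidable-stable (R? k) (¬Q-¬R′ λ ql → Q-S ql sl)

corners-absurd : ∀ {P Q R S k l} → Corners P Q R S k l → ⊥
corners-absurd {k = k} {l} c with ≤-total k l
... | inj₁ k≤l = Corners.absurd-≤ c k≤l
... | inj₂ l≤k = Corners.absurd-≤ (Corners.swap c) l≤k

record Split {n} (A H : Adj n) (v : Fin n) : Set where
  field
    k          : ℕ
    T T₁ T₂    : Family n
    X          : Subset n
    T-tangle   : IsTangle A ⊤ k T
    T₁-tangle  : IsTangle H (∁ ⁅ v ⁆) k T₁
    T₂-tangle  : IsTangle H (∁ ⁅ v ⁆) k T₂
    T₁-induces : Induces A k (∁ ⁅ v ⁆) T₁ T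
    T₂-induces : Induces A k (∁ ⁅ v ⁆) T₂ T
    T₁X        : T₁ X ≡ true
    T₂X̅        : T₂ (∁ ⁅ v ⁆ ─ X) ≡ true

-- A matrix M relating a minor Hd of deletion type and a minor Hc of contraction type of A at v.
record Comparison {n} (A Hd Hc : Adj n) (v : Fin n) : Set where
  field
    M : Adj n
    deletion-bound : ∀ X k → X ⊆ ∁ ⁅ v ⁆ → CutRankLt Hd (∁ ⁅ v ⁆) X k → Rank< M X (∁ ⁅ v ⁆ ─ X) k
    contraction-bound : ∀ Y l → Y ⊆ ∁ ⁅ v ⁆ → CutRankLt Hc (∁ ⁅ v ⁆) Y l →
      Rank< M (Y ∪ ⁅ v ⁆) ((∁ ⁅ v ⁆ ─ Y) ∪ ⁅ v ⁆) (suc l)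
    rows-avoiding-v : ∀ C Q → Q ⊆ ∁ ⁅ v ⁆ → lookup C v ≡ true →
      (∀ x c → lookup Q x ≡ true → lookup C c ≡ true → x ≢ c) → Independent A C Q → Independent M C Q
    rows-through-v : ∀ Z C Q → Q ⊆ Z → lookup Z v ≡ true → C ⊆ ∁ ⁅ v ⁆ →
      (∀ x c → lookup Z x ≡ true → lookup C c ≡ true → x ≢ c) → Independent A C Q →
      ∃ λ Q′ → Q′ ⊆ Z × ∣ Q′ ∣ ≡ ∣ Q ∣ × Independent M C Q′

∩⊆∅⇒apart : ∀ {n} (Z C : Subset n) → Z ∩ C ⊆ ∅ → ∀ x c → lookup Z x ≡ true → lookup C c ≡ true → x ≢ c
∩⊆∅⇒apart Z C h x .x x∈Z x∈C refl = ∉⊥ (h (x∈p∩q⁺ (lookup⇒∈ x∈Z , lookup⇒∈ x∈C)))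

module _ {n} {A Hd Hc : Adj n} {v : Fin n} (cmp : Comparison A Hd Hc v) where

  open Comparison cmp

  private
    W : Subset n
    W = ∁ ⁅ v ⁆

  corner-inequality : ∀ X Y k l a b → X ⊆ W → Y ⊆ W → CutRankLt Hd W X k → CutRankLt Hc W Y l → a + b ≡ k + l →
    ¬ InS A ⊤ a (X ∩ Y) → ¬ InS A ⊤ b (X ∪ Y ∪ ⁅ v ⁆) → ⊥
  corner-inequality X Y k l a b X⊆W Y⊆W ρX<k ρY<l a+b≡k+l ¬P ¬S =
    by-submodularity (¬rank<⇒independent A (⊤ ─ P) P a (λ r → ¬P (⊆⊤ , r)))
                     (¬rank<⇒independent A (⊤ ─ S) S b (λ r → ¬S (⊆⊤ , r)))
    where
    open SetExprSemantics X Y v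
    open SetExprSemantics.DecideUnder X Y v X⊆W Y⊆W
    P S C₁ C₂ : Subset n
    P = X ∩ Y
    S = X ∪ Y ∪ ⁅ v ⁆
    C₁ = W ─ X
    C₂ = (W ─ Y) ∪ ⁅ v ⁆
    v∈ : ∀ e → {_ : OnConsistentRows (λ a b e′ → truth ‵v a b e′ ⇒ᵇ truth e a b e′)} → lookup ⟦ e ⟧ v ≡ true
    v∈ e {h} = ∈⇒lookup (⟦⟧-⊆ ‵v e {h} (x∈⁅x⁆ v))
    by-submodularity : (∃ λ Q₁ → Q₁ ⊆ P × ∣ Q₁ ∣ ≡ a × Independent A (⊤ ─ P) Q₁) →
                       (∃ λ Q₂ → Q₂ ⊆ S × ∣ Q₂ ∣ ≡ b × Independent A (⊤ ─ S) Q₂) → ⊥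
    by-submodularity (Q₁ , Q₁⊆P , ∣Q₁∣≡a , indQ₁) (Q₂ , Q₂⊆S , ∣Q₂∣≡b , indQ₂)
      with Q₂′ , Q₂′⊆S , ∣Q₂′∣≡ , indQ₂′ ←
             rows-through-v S (C₁ ∩ C₂) Q₂ Q₂⊆S (v∈ (‵X ‵∪ ‵Y ‵∪ ‵v))
               (⟦⟧-⊆ ((‵W ‵─ ‵X) ‵∩ ((‵W ‵─ ‵Y) ‵∪ ‵v)) ‵W)
               (∩⊆∅⇒apart S (C₁ ∩ C₂) (⟦⟧-⊆ ((‵X ‵∪ ‵Y ‵∪ ‵v) ‵∩ (‵W ‵─ ‵X) ‵∩ ((‵W ‵─ ‵Y) ‵∪ ‵v)) ‵∅))
               (independent-cols {w = A} (⟦⟧-⊆ (‵⊤ ‵─ (‵X ‵∪ ‵Y ‵∪ ‵v)) ((‵W ‵─ ‵X) ‵∩ ((‵W ‵─ ‵Y) ‵∪ ‵v))) indQ₂) =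
      <-irrefl refl (begin-strict
        1 + (k + l)               ≡⟨ cong suc (sym a+b≡k+l) ⟩
        1 + (a + b)               ≡⟨ cong suc (sym (cong₂ _+_ ∣Q₁∣≡a (trans ∣Q₂′∣≡ ∣Q₂∣≡b))) ⟩
        1 + (∣ Q₁ ∣ + ∣ Q₂′ ∣)    <⟨ n<1+n _ ⟩
        2 + (∣ Q₁ ∣ + ∣ Q₂′ ∣)    ≤⟨ matrix-submodular {M = M} (deletion-bound X k X⊆W ρX<k)
                                                          (contraction-bound Y l Y⊆W ρY<l)
                                       (⊆-trans Q₁⊆P (⟦⟧-⊆ (‵X ‵∩ ‵Y) (‵X ‵∩ (‵Y ‵∪ ‵v)))) indQ₁′ Q₂′⊆S indQ₂′ ⟩
        k + suc l                 ≡⟨ +-suc k l ⟩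
        suc (k + l)               ∎)
      where
      open ≤-Reasoning
      indQ₁′ : Independent M (C₁ ∪ C₂) Q₁
      indQ₁′ = rows-avoiding-v (C₁ ∪ C₂) Q₁ (⊆-trans Q₁⊆P (⟦⟧-⊆ (‵X ‵∩ ‵Y) ‵W))
        (v∈ ((‵W ‵─ ‵X) ‵∪ (‵W ‵─ ‵Y) ‵∪ ‵v))
        (λ x c x∈Q₁ → ∩⊆∅⇒apart P (C₁ ∪ C₂) (⟦⟧-⊆ ((‵X ‵∩ ‵Y) ‵∩ ((‵W ‵─ ‵X) ‵∪ (‵W ‵─ ‵Y) ‵∪ ‵v)) ‵∅)
                                x c (⊆-elim Q₁⊆P x x∈Q₁))
        (independent-cols {w = A} (⟦⟧-⊆ (‵⊤ ‵─ (‵X ‵∩ ‵Y)) ((‵W ‵─ ‵X) ‵∪ (‵W ‵─ ‵Y) ‵∪ ‵v)) indQ₁)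

  no-two-splits : Split A Hd v → Split A Hc v → ⊥
  no-two-splits d₁ d₂ = corners-absurd {k = k} {l} (record
    { P? = λ m → InS? A ⊤ m P ; Q? = λ m → InS? A ⊤ m Q ; R? = λ m → InS? A ⊤ m R ; S? = λ m → InS? A ⊤ m S
    ; P-mono = InS-mono A P ; Q-mono = InS-mono A Q ; R-mono = InS-mono A R
    ; ¬P-¬S  = corner-inequality X Y k l k l X⊆W Y⊆W ρX<k ρY<l refl
    ; ¬P-¬S′ = corner-inequality X Y k l l k X⊆W Y⊆W ρX<k ρY<l (+-comm l k)
    ; ¬Q-¬R  = corner-inequality X Y̅ k l k l X⊆W Y̅⊆W ρX<k ρY̅<l refl
    ; ¬Q-¬R′ = corner-inequality X Y̅ k l l k X⊆W Y̅⊆W ρX<k ρY̅<l (+-comm l k)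
    ; P-Q = P-Q ; R-S = R-S ; P-R = P-R ; Q-S = Q-S
    })
    where
    open Split d₁
    module d₂ = Split d₂
    l : ℕ
    l = d₂.k
    Y Y̅ : Subset n
    Y = d₂.X
    Y̅ = W ─ Y
    X⊆W : X ⊆ W
    X⊆W = proj₁ (IsTangle.inS T₁-tangle X T₁X)
    ρX<k : CutRankLt Hd W X k
    ρX<k = proj₂ (IsTangle.inS T₁-tangle X T₁X)
    Y⊆W : Y ⊆ W
    Y⊆W = proj₁ (IsTangle.inS d₂.T₁-tangle Y d₂.T₁X)
    ρY<l : CutRankLt Hc W Y l
    ρY<l = proj₂ (IsTangle.inS d₂.T₁-tangle Y d₂.T₁X)
    Y̅⊆W : Y̅ ⊆ W
    Y̅⊆W = p─q⊆p W Y
    ρY̅<l : CutRankLt Hc W Y̅ l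
    ρY̅<l = proj₂ (IsTangle.inS d₂.T₂-tangle Y̅ d₂.T₂X̅)
    open SetExprSemantics X Y v
    open SetExprSemantics.DecideUnder X Y v X⊆W Y⊆W
    ‵P ‵Q ‵R ‵S : SetExpr
    ‵P = ‵X ‵∩ ‵Y
    ‵Q = ‵X ‵∩ (‵W ‵─ ‵Y)
    ‵R = ‵X ‵∪ (‵W ‵─ ‵Y) ‵∪ ‵v
    ‵S = ‵X ‵∪ ‵Y ‵∪ ‵v
    P Q R S : Subset n
    P = ⟦ ‵P ⟧
    Q = ⟦ ‵Q ⟧
    R = ⟦ ‵R ⟧
    S = ⟦ ‵S ⟧

    P-Q : InS A ⊤ k P → ¬ InS A ⊤ k Q
    P-Q p q = IsTangle.noCover T₂-tangle _ _ (W ─ X)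
      (proj₂ (small-agree P p (⟦⟧-⊆ (‵P ‵∩ ‵W) ‵X))) (proj₂ (small-agree Q q (⟦⟧-⊆ (‵Q ‵∩ ‵W) ‵X))) T₂X̅
      (⟦⟧-≡ ((‵P ‵∩ ‵W) ‵∪ (‵Q ‵∩ ‵W) ‵∪ (‵W ‵─ ‵X)) ‵W)
      where open InducingTangles {T₂ = T₂} T-tangle T₁-tangle T₁-induces T₂-induces X T₁X X⊆W

    R-S : InS A ⊤ k R → ¬ InS A ⊤ k S
    R-S r s = IsTangle.noCover T₁-tangle _ _ X
      (proj₂ (co-small-agree R r (⟦⟧-⊆ ((‵⊤ ‵─ ‵R) ‵∩ ‵W) (‵W ‵─ ‵X))))
      (proj₂ (co-small-agree S s (⟦⟧-⊆ ((‵⊤ ‵─ ‵S) ‵∩ ‵W) (‵W ‵─ ‵X)))) T₁X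
      (⟦⟧-≡ (((‵⊤ ‵─ ‵R) ‵∩ ‵W) ‵∪ ((‵⊤ ‵─ ‵S) ‵∩ ‵W) ‵∪ ‵X) ‵W)
      where open InducingTangles {T₂ = T₁} T-tangle T₂-tangle T₂-induces T₁-induces (W ─ X) T₂X̅ (p─q⊆p W X)

    P-R : InS A ⊤ l P → ¬ InS A ⊤ l R
    P-R p r = IsTangle.noCover d₂.T₂-tangle _ _ Y̅
      (proj₂ (small-agree P p (⟦⟧-⊆ (‵P ‵∩ ‵W) ‵Y))) (proj₂ (co-small-agree R r (⟦⟧-⊆ ((‵⊤ ‵─ ‵R) ‵∩ ‵W) ‵Y))) d₂.T₂X̅
      (⟦⟧-≡ ((‵P ‵∩ ‵W) ‵∪ ((‵⊤ ‵─ ‵R) ‵∩ ‵W) ‵∪ (‵W ‵─ ‵Y)) ‵W)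
      where open InducingTangles {T₂ = d₂.T₂} d₂.T-tangle d₂.T₁-tangle d₂.T₁-induces d₂.T₂-induces Y d₂.T₁X Y⊆W

    Q-S : InS A ⊤ l Q → ¬ InS A ⊤ l S
    Q-S q s = IsTangle.noCover d₂.T₁-tangle _ _ Y
      (proj₂ (small-agree Q q (⟦⟧-⊆ (‵Q ‵∩ ‵W) (‵W ‵─ ‵Y))))
      (proj₂ (co-small-agree S s (⟦⟧-⊆ ((‵⊤ ‵─ ‵S) ‵∩ ‵W) (‵W ‵─ ‵Y)))) d₂.T₁X
      (⟦⟧-≡ ((‵Q ‵∩ ‵W) ‵∪ ((‵⊤ ‵─ ‵S) ‵∩ ‵W) ‵∪ ‵Y) ‵W)
      where open InducingTangles {T₂ = d₂.T₁} d₂.T-tangle d₂.T₂-tangle d₂.T₂-induces d₂.T₁-induces Y̅ d₂.T₂X̅ Y̅⊆W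

*-≢ : ∀ {n} (B : Adj n) w {p q} → p ≢ q → (B * w) p q ≡ B p q xor (B w p ∧ B w q)
*-≢ B w {p} {q} p≢q =
  trans (cong (λ t → B p q xor (B w p ∧ B w q ∧ not t)) (δ-≢ p≢q))
        (cong (λ t → B p q xor (B w p ∧ t)) (∧-identityʳ (B w q)))

*-diag : ∀ {n} (B : Adj n) w p → (B * w) p p ≡ B p p
*-diag B w p = trans (cong (λ t → B p p xor (B w p ∧ B w p ∧ not t)) (δ-refl p))
                     (trans (cong (λ t → B p p xor (B w p ∧ t)) (∧-zeroʳ (B w p)))
                            (trans (cong (B p p xor_) (∧-zeroʳ (B w p))) (xor-identityʳ (B p p))))

module PivotEntries {n} (A : Adj n) (simple : Simple A) (v u : Fin n) (vu : A v u ≡ true) where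

  private
    A-sym : ∀ x y → A x y ≡ A y x
    A-sym = proj₁ simple
    A-loopless : ∀ x → A x x ≡ false
    A-loopless = proj₂ simple

  u≢v : u ≢ v
  u≢v refl = false≢true (trans (sym (A-loopless v)) vu)

  uv : A u v ≡ true
  uv = trans (A-sym u v) vu

  private
    A₁ A₂ : Adj n
    A₁ = A * v
    A₂ = A₁ * u

    A₁-v : ∀ {q} → q ≢ v → A₁ v q ≡ A v q
    A₁-v {q} q≢v = trans (*-≢ A v (q≢v ∘ sym))
                         (trans (cong (λ t → A v q xor (t ∧ A v q)) (A-loopless v)) (xor-identityʳ _))

    A₁-uv : A₁ u v ≡ true
    A₁-uv = trans (*-≢ A v u≢v)
                  (trans (cong₂ (λ s t → s xor (A v u ∧ t)) uv (A-loopless v)) (cong (true xor_) (∧-zeroʳ _)))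

    A₁-uu : A₁ u u ≡ false
    A₁-uu = trans (*-diag A v u) (A-loopless u)

    A₁-u : ∀ {q} → q ≢ u → A₁ u q ≡ A u q xor A v q
    A₁-u {q} q≢u = trans (*-≢ A v (q≢u ∘ sym)) (cong (λ t → A u q xor (t ∧ A v q)) vu)

    A₂-v : ∀ {q} → q ≢ u → q ≢ v → A₂ v q ≡ A u q
    A₂-v {q} q≢u q≢v = begin
      A₂ v q                                    ≡⟨ *-≢ A₁ u (q≢v ∘ sym) ⟩
      A₁ v q xor (A₁ u v ∧ A₁ u q)              ≡⟨ cong₂ (λ s t → s xor (t ∧ A₁ u q)) (A₁-v q≢v) A₁-uv ⟩
      A v q xor A₁ u q                          ≡⟨ cong (A v q xor_) (A₁-u q≢u) ⟩
      A v q xor (A u q xor A v q)               ≡⟨ solve 2 (λ a b → a :+ (b :+ a) := b) refl (A v q) (A u q) ⟩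
      A u q                                     ∎
      where open ≡-Reasoning

    A₂-vu : A₂ v u ≡ true
    A₂-vu = trans (*-≢ A₁ u (u≢v ∘ sym))
                  (trans (cong₂ (λ s t → s xor (A₁ u v ∧ t)) (trans (A₁-v u≢v) vu) A₁-uu)
                         (cong (true xor_) (∧-zeroʳ _)))

    A₂-u : ∀ {q} → q ≢ u → A₂ u q ≡ A u q xor A v q
    A₂-u {q} q≢u = trans (*-≢ A₁ u (q≢u ∘ sym))
                         (trans (cong (λ t → A₁ u q xor (t ∧ A₁ u q)) A₁-uu) (trans (xor-identityʳ _) (A₁-u q≢u)))

  pivot-u : ∀ {c} → c ≢ u → c ≢ v → pivot A v u u c ≡ A v c
  pivot-u {c} c≢u c≢v = begin
    pivot A v u u c                               ≡⟨ *-≢ A₂ v (c≢u ∘ sym) ⟩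
    A₂ u c xor (A₂ v u ∧ A₂ v c)                  ≡⟨ cong₂ _xor_ (A₂-u c≢u) (cong₂ _∧_ A₂-vu (A₂-v c≢u c≢v)) ⟩
    (A u c xor A v c) xor (true ∧ A u c)          ≡⟨ solve 2 (λ a b → (a :+ b) :+ a := b) refl (A u c) (A v c) ⟩
    A v c                                         ∎
    where open ≡-Reasoning

  pivot-col-u : ∀ {x} → x ≢ u → x ≢ v → pivot A v u x u ≡ A x v
  pivot-col-u {x} x≢u x≢v = begin
    pivot A v u x u                               ≡⟨ *-≢ A₂ v x≢u ⟩
    A₂ x u xor (A₂ v x ∧ A₂ v u)                  ≡⟨ cong₂ (λ s t → s xor (t ∧ A₂ v u)) A₂-xu (A₂-v x≢u x≢v) ⟩
    (A x u xor A v x) xor (A u x ∧ A₂ v u)        ≡⟨ cong₂ (λ s t → (s xor A v x) xor (A u x ∧ t)) (A-sym x u) A₂-vu ⟩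
    (A u x xor A v x) xor (A u x ∧ true)          ≡⟨ cong ((A u x xor A v x) xor_) (∧-identityʳ (A u x)) ⟩
    (A u x xor A v x) xor A u x                   ≡⟨ solve 2 (λ a b → (a :+ b) :+ a := b) refl (A u x) (A v x) ⟩
    A v x                                         ≡⟨ A-sym v x ⟩
    A x v                                         ∎
    where
    open ≡-Reasoning
    A₂-xu : A₂ x u ≡ A x u xor A v x
    A₂-xu = begin
      A₂ x u                           ≡⟨ *-≢ A₁ u x≢u ⟩
      A₁ x u xor (A₁ u x ∧ A₁ u u)     ≡⟨ cong (λ t → A₁ x u xor (A₁ u x ∧ t)) A₁-uu ⟩
      A₁ x u xor (A₁ u x ∧ false)      ≡⟨ trans (cong (A₁ x u xor_) (∧-zeroʳ _)) (xor-identityʳ _) ⟩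
      A₁ x u                           ≡⟨ *-≢ A v x≢u ⟩
      A x u xor (A v x ∧ A v u)        ≡⟨ cong (λ t → A x u xor (A v x ∧ t)) vu ⟩
      A x u xor (A v x ∧ true)         ≡⟨ cong (A x u xor_) (∧-identityʳ _) ⟩
      A x u xor A v x                  ∎

  pivot-off : ∀ {x c} → x ≢ c → x ≢ u → x ≢ v → c ≢ u → c ≢ v →
    pivot A v u x c ≡ (A x c xor (A x u ∧ A v c)) xor (A x v ∧ A u c)
  pivot-off {x} {c} x≢c x≢u x≢v c≢u c≢v = begin
    pivot A v u x c
      ≡⟨ *-≢ A₂ v x≢c ⟩
    A₂ x c xor (A₂ v x ∧ A₂ v c)
      ≡⟨ cong₂ _xor_ A₂-xc (cong₂ _∧_ (A₂-v x≢u x≢v) (A₂-v c≢u c≢v)) ⟩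
    ((A x c xor (A v x ∧ A v c)) xor ((A u x xor A v x) ∧ (A u c xor A v c))) xor (A u x ∧ A u c)
      ≡⟨ solve 5 (λ a vx vc ux uc → ((a :+ (vx :* vc)) :+ ((ux :+ vx) :* (uc :+ vc))) :+ (ux :* uc)
                                    := (a :+ (ux :* vc)) :+ (vx :* uc))
                 refl (A x c) (A v x) (A v c) (A u x) (A u c) ⟩
    (A x c xor (A u x ∧ A v c)) xor (A v x ∧ A u c)
      ≡⟨ cong₂ (λ s t → (A x c xor (s ∧ A v c)) xor (t ∧ A u c)) (A-sym u x) (A-sym v x) ⟩
    (A x c xor (A x u ∧ A v c)) xor (A x v ∧ A u c)
      ∎
    where
    open ≡-Reasoning
    A₂-xc : A₂ x c ≡ (A x c xor (A v x ∧ A v c)) xor ((A u x xor A v x) ∧ (A u c xor A v c))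
    A₂-xc = trans (*-≢ A₁ u x≢c) (cong₂ _xor_ (*-≢ A v x≢c) (cong₂ _∧_ (A₁-u x≢u) (A₁-u c≢u)))

rowSum-add-column : ∀ {m d} (P : Subset m) (w w′ : Fin m → Fin d → Bool) c c₀ h →
  (∀ x → lookup P x ≡ true → w x c ≡ w′ x c xor (w′ x c₀ ∧ h)) → rowSum P w c ≡ rowSum P w′ c xor (h ∧ rowSum P w′ c₀)
rowSum-add-column P w w′ c c₀ h w≡ = begin
  rowSum P w c
    ≡⟨ rowSum-cong P w (λ x c → w′ x c xor (w′ x c₀ ∧ h)) c w≡ ⟩
  parity (λ x → lookup P x ∧ (w′ x c xor (w′ x c₀ ∧ h)))
    ≡⟨ parity-cong (λ x → solve 4 (λ p a b t → p :* (a :+ (b :* t)) := (p :* a) :+ (t :* (p :* b))) refl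
                                  (lookup P x) (w′ x c) (w′ x c₀) h) ⟩
  parity (λ x → (lookup P x ∧ w′ x c) xor (h ∧ (lookup P x ∧ w′ x c₀)))
    ≡⟨ parity-xor (λ x → lookup P x ∧ w′ x c) (λ x → h ∧ (lookup P x ∧ w′ x c₀)) ⟩
  rowSum P w′ c xor parity (λ x → h ∧ (lookup P x ∧ w′ x c₀))
    ≡⟨ cong (rowSum P w′ c xor_) (parity-∧ˡ h (λ x → lookup P x ∧ w′ x c₀)) ⟩
  rowSum P w′ c xor (h ∧ rowSum P w′ c₀) ∎
  where open ≡-Reasoning

module _ {m d : ℕ} {C : Subset d} where

  independent-cong : ∀ {w w′ : Fin m → Fin d → Bool} {Q : Subset m} →
    (∀ x c → lookup Q x ≡ true → lookup C c ≡ true → w x c ≡ w′ x c) → Independent w C Q → Independent w′ C Q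
  independent-cong {w} {w′} {Q} w≡w′ ind P P⊆Q ne =
    let (c , c∈C , e) = ind P P⊆Q ne
    in c , c∈C , trans (sym (rowSum-cong P w w′ c λ x x∈P → w≡w′ x c (⊆-elim P⊆Q x x∈P) (∈⇒lookup c∈C))) e

  Rank<-cong : ∀ {w w′ : Fin m → Fin d → Bool} {R : Subset m} {k} →
    (∀ x c → lookup R x ≡ true → lookup C c ≡ true → w x c ≡ w′ x c) → Rank< w R C k → Rank< w′ R C k
  Rank<-cong w≡w′ r Q Q⊆R eQ ind =
    r Q Q⊆R eQ (independent-cong (λ x c x∈Q c∈C → sym (w≡w′ x c (⊆-elim Q⊆R x x∈Q) c∈C)) ind)

  Rank<-insert-row : ∀ {w : Fin m → Fin d → Bool} {R : Subset m} {k} y → Rank< w R C k → Rank< w (R ∪ ⁅ y ⁆) C (suc k)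
  Rank<-insert-row {w} {R} {k} y r Q Q⊆ eQ ind =
    let (Q′ , Q′⊆ , e) = subset-of-size k (Q ─ ⁅ y ⁆) (≤-pred (subst (_≤ suc ∣ Q ─ ⁅ y ⁆ ∣) eQ (∣p∣≤1+∣p─⁅y⁆∣ Q y)))
    in r Q′ (⊆-trans Q′⊆ Q─y⊆R) e (independent-⊆ {w = w} {C} (⊆-trans Q′⊆ (p─q⊆p Q ⁅ y ⁆)) ind)
    where
    Q─y⊆R : Q ─ ⁅ y ⁆ ⊆ R
    Q─y⊆R {x} x∈ with x ≟ y
    ... | yes refl = ⊥-elim (x∈p─q⇒x∉q x∈ (x∈⁅x⁆ y))
    ... | no x≢y = [ id , (λ x∈y → ⊥-elim (x≢y (x∈⁅y⁆⇒x≡y y x∈y))) ]′ (x∈p∪q⁻ R ⁅ y ⁆ (Q⊆ (p─q⊆p Q ⁅ y ⁆ x∈)))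

  Rank<-zero-column : ∀ {w : Fin m → Fin d → Bool} {R : Subset m} {k} c₀ →
    (∀ x → lookup R x ≡ true → w x c₀ ≡ false) → Rank< w R C k → Rank< w R (C ∪ ⁅ c₀ ⁆) k
  Rank<-zero-column {w} c₀ zero-col r Q Q⊆R eQ ind = r Q Q⊆R eQ λ P P⊆Q ne →
    let (c , c∈ , e) = ind P P⊆Q ne in
    case x∈p∪q⁻ C ⁅ c₀ ⁆ c∈ of λ where
      (inj₁ c∈C)  → c , c∈C , e
      (inj₂ c∈c₀) → ⊥-elim (false≢true (trans (sym (vanishes P P⊆Q))
                                              (subst (λ c → rowSum P w c ≡ true) (x∈⁅y⁆⇒x≡y c₀ c∈c₀) e)))
    where
    vanishes : ∀ P → P ⊆ Q → rowSum P w c₀ ≡ false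
    vanishes P P⊆Q = trans (rowSum-cong P w (λ _ _ → false) c₀ λ x x∈P → zero-col x (⊆-elim (⊆-trans P⊆Q Q⊆R) x x∈P))
                           (trans (parity-cong (λ x → ∧-zeroʳ (lookup P x))) (parity-false {m}))

  independent-column-operation : ∀ {w w′ : Fin m → Fin d → Bool} {Q : Subset m} c₀ (h : Fin d → Bool) →
    lookup C c₀ ≡ true → (∀ x c → lookup Q x ≡ true → lookup C c ≡ true → w x c ≡ w′ x c xor (w′ x c₀ ∧ h c)) →
    Independent w C Q → Independent w′ C Q
  independent-column-operation {w} {w′} {Q} c₀ h c₀∈C w≡ ind P P⊆Q ne with ind P P⊆Q ne | rowSum P w′ c₀ in e₀
  ... | _           | true  = c₀ , lookup⇒∈ c₀∈C , e₀
  ... | c , c∈C , e | false = c , c∈C , (begin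
    rowSum P w′ c                             ≡⟨ xor-identityʳ _ ⟨
    rowSum P w′ c xor false                   ≡⟨ cong (rowSum P w′ c xor_) (trans (cong (h c ∧_) e₀) (∧-zeroʳ (h c))) ⟨
    rowSum P w′ c xor (h c ∧ rowSum P w′ c₀)  ≡⟨ rowSum-add-column P w w′ c c₀ (h c)
                                                    (λ x x∈P → w≡ x c (⊆-elim P⊆Q x x∈P) (∈⇒lookup c∈C)) ⟨
    rowSum P w c                              ≡⟨ e ⟩
    true                                      ∎)
    where open ≡-Reasoning

infix 8 _·⁅_⁆

_·⁅_⁆ : ∀ {n} → Bool → Fin n → Subset n
b ·⁅ y ⁆ = if b then ⁅ y ⁆ else ∅

rowSum-·⁅⁆ : ∀ {m d} b (y : Fin m) (w : Fin m → Fin d → Bool) c → rowSum (b ·⁅ y ⁆) w c ≡ b ∧ w y c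
rowSum-·⁅⁆ true  y w c = rowSum-⁅⁆ y w c
rowSum-·⁅⁆ false y w c = rowSum-∅ w c

·⁅⁆⊆ : ∀ {n} b (y : Fin n) {Z : Subset n} → lookup Z y ≡ true → b ·⁅ y ⁆ ⊆ Z
·⁅⁆⊆ true  y y∈Z = ⁅⁆⊆ y y∈Z
·⁅⁆⊆ false y _   = ⊥⊆

module _ {m d : ℕ} (w : Fin m → Fin d → Bool) (C : Subset d) {Z : Subset m} {r : Fin d → Bool} where

  private
    rowSum-⁅⁆⊕ : ∀ x b y c → rowSum (⁅ x ⁆ ⊕ b ·⁅ y ⁆) w c ≡ w x c xor (b ∧ w y c)
    rowSum-⁅⁆⊕ x b y c = trans (rowSum-⊕ ⁅ x ⁆ (b ·⁅ y ⁆) w c) (cong₂ _xor_ (rowSum-⁅⁆ x w c) (rowSum-·⁅⁆ b y w c))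

  span-⁅⁆ : ∀ x → lookup Z x ≡ true → (∀ c → lookup C c ≡ true → w x c ≡ r c) → InSpan w C Z r
  span-⁅⁆ x x∈Z eq = ⁅ x ⁆ , ⁅⁆⊆ x x∈Z , λ c c∈C → sym (trans (rowSum-⁅⁆ x w c) (eq c c∈C))

  span-⁅⁆⊕ : ∀ x b y → lookup Z x ≡ true → lookup Z y ≡ true →
    (∀ c → lookup C c ≡ true → w x c xor (b ∧ w y c) ≡ r c) → InSpan w C Z r
  span-⁅⁆⊕ x b y x∈Z y∈Z eq = ⁅ x ⁆ ⊕ b ·⁅ y ⁆ , ⊕-least (⁅⁆⊆ x x∈Z) (·⁅⁆⊆ b y y∈Z) , λ c c∈C →
    sym (trans (rowSum-⁅⁆⊕ x b y c) (eq c c∈C))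

  span-⁅⁆⊕⊕ : ∀ x b y b′ y′ → lookup Z x ≡ true → lookup Z y ≡ true → lookup Z y′ ≡ true →
    (∀ c → lookup C c ≡ true → (w x c xor (b ∧ w y c)) xor (b′ ∧ w y′ c) ≡ r c) → InSpan w C Z r
  span-⁅⁆⊕⊕ x b y b′ y′ x∈Z y∈Z y′∈Z eq =
    ⁅ x ⁆ ⊕ b ·⁅ y ⁆ ⊕ b′ ·⁅ y′ ⁆ , ⊕-least (⊕-least (⁅⁆⊆ x x∈Z) (·⁅⁆⊆ b y y∈Z)) (·⁅⁆⊆ b′ y′ y′∈Z) , λ c c∈C →
      sym (trans (rowSum-⊕ (⁅ x ⁆ ⊕ b ·⁅ y ⁆) (b′ ·⁅ y′ ⁆) w c)
                 (trans (cong₂ _xor_ (rowSum-⁅⁆⊕ x b y c) (rowSum-·⁅⁆ b′ y′ w c)) (eq c c∈C)))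

module EdgeComparisons {n} (A : Adj n) (simple : Simple A) (v u : Fin n) (vu : A v u ≡ true) where

  open PivotEntries A simple v u vu

  private
    A-sym : ∀ x y → A x y ≡ A y x
    A-sym = proj₁ simple
    A-loopless : ∀ x → A x x ≡ false
    A-loopless = proj₂ simple
    W : Subset n
    W = ∁ ⁅ v ⁆
    piv : Adj n
    piv = pivot A v u

  Rows Cols : Subset n → Subset n
  Rows Y = Y ∪ ⁅ v ⁆
  Cols Y = (W ─ Y) ∪ ⁅ v ⁆

  ∈W⇒≢v : ∀ {x} → lookup W x ≡ true → x ≢ v
  ∈W⇒≢v x∈W refl = x∈p⇒x∉∁p (x∈⁅x⁆ v) (lookup⇒∈ x∈W)

  ∈-∪⁅v⁆ : ∀ Z {x} → lookup (Z ∪ ⁅ v ⁆) x ≡ true → x ≡ v ⊎ lookup Z x ≡ true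
  ∈-∪⁅v⁆ Z x∈ = [ inj₂ ∘ ∈⇒lookup , inj₁ ∘ x∈⁅y⁆⇒x≡y v ]′ (x∈p∪q⁻ Z ⁅ v ⁆ (lookup⇒∈ x∈))

  v∈-∪⁅v⁆ : ∀ Z → lookup (Z ∪ ⁅ v ⁆) v ≡ true
  v∈-∪⁅v⁆ Z = ⊆-elim (q⊆p∪q Z ⁅ v ⁆) v (∈⇒lookup (x∈⁅x⁆ v))

  ∈-∪⁅v⁆⁺ : ∀ Z {x} → lookup Z x ≡ true → lookup (Z ∪ ⁅ v ⁆) x ≡ true
  ∈-∪⁅v⁆⁺ Z = ⊆-elim (p⊆p∪q {p = Z} ⁅ v ⁆) _

  ∈W─Y : ∀ Y {c} → lookup (W ─ Y) c ≡ true → c ≢ v × lookup Y c ≡ false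
  ∈W─Y Y {c} c∈ = ∈W⇒≢v (⊆-elim (p─q⊆p W Y) c c∈) , ¬-not (x∈p─q⇒x∉q {p = W} {Y} (lookup⇒∈ c∈) ∘ lookup⇒∈)

  rows-cases : ∀ Y → Y ⊆ W → ∀ {x} → lookup (Rows Y) x ≡ true → x ≡ v ⊎ (x ≢ v × lookup Y x ≡ true)
  rows-cases Y Y⊆W {x} x∈ = Data.Sum.map₂ (λ x∈Y → ∈W⇒≢v (⊆-elim Y⊆W x x∈Y) , x∈Y) (∈-∪⁅v⁆ Y x∈)

  cols-cases : ∀ Y {c} → lookup (Cols Y) c ≡ true → c ≡ v ⊎ (c ≢ v × lookup Y c ≡ false)
  cols-cases Y c∈ = Data.Sum.map₂ (∈W─Y Y) (∈-∪⁅v⁆ (W ─ Y) c∈)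

  apart : ∀ (Y : Subset n) {x c} → lookup Y x ≡ true → lookup Y c ≡ false → x ≢ c
  apart Y x∈Y c∉Y refl = false≢true (trans (sym c∉Y) x∈Y)

  withRow : Adj n → (Fin n → Bool) → Adj n
  withRow H r x c = if δ x v then r c else if δ c v then false else H x c

  withRow-v : ∀ H r c → withRow H r v c ≡ r c
  withRow-v H r c rewrite δ-refl v = refl

  withRow-col-v : ∀ H r {x} → x ≢ v → withRow H r x v ≡ false
  withRow-col-v H r x≢v rewrite δ-≢ x≢v | δ-refl v = refl

  withRow-off : ∀ H r {x c} → x ≢ v → c ≢ v → withRow H r x c ≡ H x c
  withRow-off H r x≢v c≢v rewrite δ-≢ x≢v | δ-≢ c≢v = refl

  contraction-by-span : ∀ (M H : Adj n) (r : Fin n → Bool) Y l → Y ⊆ W →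
    (∀ x → lookup (Rows Y) x ≡ true → InSpan (withRow H r) (Cols Y) (Rows Y) (M x)) →
    CutRankLt H W Y l → Rank< M (Rows Y) (Cols Y) (suc l)
  contraction-by-span M H r Y l Y⊆W spans ρY<l =
    Rank<-span {w₁ = M} {w₂ = withRow H r} spans
      (Rank<-insert-row {w = withRow H r} v
        (Rank<-zero-column {w = withRow H r} v (λ x x∈Y → withRow-col-v H r (≢v x∈Y))
          (Rank<-cong {w = H} (λ x c x∈Y c∈ → sym (withRow-off H r (≢v x∈Y) (proj₁ (∈W─Y Y c∈)))) ρY<l)))
    where
    ≢v : ∀ {x} → lookup Y x ≡ true → x ≢ v
    ≢v {x} x∈Y = ∈W⇒≢v (⊆-elim Y⊆W x x∈Y)

  pivot-spans-u∈Y : ∀ Y → Y ⊆ W → lookup Y u ≡ true → ∀ x → lookup (Rows Y) x ≡ true →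
    InSpan (withRow piv (A u)) (Cols Y) (Rows Y) (A x)
  pivot-spans-u∈Y Y Y⊆W u∈Y x x∈ with rows-cases Y Y⊆W x∈
  ... | inj₁ refl = span-⁅⁆ (withRow piv (A u)) (Cols Y) u (∈-∪⁅v⁆⁺ Y u∈Y) row-u
    where
    row-u : ∀ c → lookup (Cols Y) c ≡ true → withRow piv (A u) u c ≡ A v c
    row-u c c∈ with cols-cases Y c∈
    ... | inj₁ refl = trans (withRow-col-v piv (A u) u≢v) (sym (A-loopless v))
    ... | inj₂ (c≢v , c∉Y) = trans (withRow-off piv (A u) u≢v c≢v) (pivot-u (apart Y u∈Y c∉Y ∘ sym) c≢v)
  ... | inj₂ (x≢v , x∈Y) with x ≟ u
  ...   | yes refl = span-⁅⁆ (withRow piv (A u)) (Cols Y) v (v∈-∪⁅v⁆ Y) λ c _ → withRow-v piv (A u) c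
  ...   | no x≢u = span-⁅⁆⊕⊕ N (Cols Y) x (A x v) v (A x u) u x∈ (v∈-∪⁅v⁆ Y) (∈-∪⁅v⁆⁺ Y u∈Y) entry
    where
    N : Adj n
    N = withRow piv (A u)
    open ≡-Reasoning
    entry : ∀ c → lookup (Cols Y) c ≡ true → (N x c xor (A x v ∧ N v c)) xor (A x u ∧ N u c) ≡ A x c
    entry c c∈ with cols-cases Y c∈
    ... | inj₁ refl = begin
      (N x v xor (A x v ∧ N v v)) xor (A x u ∧ N u v)
        ≡⟨ cong₂ (λ s t → (s xor (A x v ∧ t)) xor (A x u ∧ N u v))
                 (withRow-col-v piv (A u) x≢v) (trans (withRow-v piv (A u) v) uv) ⟩
      (A x v ∧ true) xor (A x u ∧ N u v)
        ≡⟨ cong₂ (λ s t → s xor (A x u ∧ t)) (∧-identityʳ (A x v)) (withRow-col-v piv (A u) u≢v) ⟩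
      A x v xor (A x u ∧ false)
        ≡⟨ trans (cong (A x v xor_) (∧-zeroʳ (A x u))) (xor-identityʳ (A x v)) ⟩
      A x v ∎
    ... | inj₂ (c≢v , c∉Y) = begin
      (N x c xor (A x v ∧ N v c)) xor (A x u ∧ N u c)
        ≡⟨ cong (λ t → (N x c xor (A x v ∧ t)) xor (A x u ∧ N u c)) (withRow-v piv (A u) c) ⟩
      (N x c xor (A x v ∧ A u c)) xor (A x u ∧ N u c)
        ≡⟨ cong₂ (λ s t → (s xor (A x v ∧ A u c)) xor (A x u ∧ t))
                 (trans (withRow-off piv (A u) x≢v c≢v) (pivot-off (apart Y x∈Y c∉Y) x≢u x≢v c≢u c≢v))
                 (trans (withRow-off piv (A u) u≢v c≢v) (pivot-u c≢u c≢v)) ⟩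
      (((A x c xor (A x u ∧ A v c)) xor (A x v ∧ A u c)) xor (A x v ∧ A u c)) xor (A x u ∧ A v c)
        ≡⟨ solve 3 (λ a p q → (((a :+ p) :+ q) :+ q) :+ p := a) refl (A x c) (A x u ∧ A v c) (A x v ∧ A u c) ⟩
      A x c ∎
      where
      c≢u : c ≢ u
      c≢u = apart Y u∈Y c∉Y ∘ sym

  A′ : Adj n
  A′ x c = if δ c u then A x v else if δ c v then A x u else A x c xor (A u c ∧ A x v)

  A′-u : ∀ x → A′ x u ≡ A x v
  A′-u x rewrite δ-refl u = refl

  A′-v : ∀ x → A′ x v ≡ A x u
  A′-v x rewrite δ-≢ (u≢v ∘ sym) | δ-refl v = refl

  A′-off : ∀ x {c} → c ≢ u → c ≢ v → A′ x c ≡ A x c xor (A x v ∧ A u c)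
  A′-off x {c} c≢u c≢v rewrite δ-≢ c≢u | δ-≢ c≢v = cong (A x c xor_) (∧-comm (A u c) (A x v))

  A′-independent : ∀ C Q → lookup C u ≡ true → lookup C v ≡ true → Independent A C Q → Independent A′ C Q
  A′-independent C Q u∈C v∈C ind P P⊆Q ne with ind P P⊆Q ne
  ... | c , c∈C , e with c ≟ u | c ≟ v
  ...   | yes refl | _        = v , lookup⇒∈ v∈C , trans (rowSum-cong P A′ (λ x _ → A x u) v (λ x _ → A′-v x)) e
  ...   | no _     | yes refl = u , lookup⇒∈ u∈C , trans (rowSum-cong P A′ (λ x _ → A x v) u (λ x _ → A′-u x)) e
  ...   | no c≢u   | no c≢v with rowSum P A v in e-v
  ...     | true  = u , lookup⇒∈ u∈C , trans (rowSum-cong P A′ (λ x _ → A x v) u (λ x _ → A′-u x)) e-v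
  ...     | false = c , c∈C , (begin
    rowSum P A′ c                           ≡⟨ rowSum-add-column P A′ A c v (A u c) (λ x _ → A′-off x c≢u c≢v) ⟩
    rowSum P A c xor (A u c ∧ rowSum P A v) ≡⟨ cong₂ (λ s t → s xor (A u c ∧ t)) e e-v ⟩
    true xor (A u c ∧ false)                ≡⟨ cong (true xor_) (∧-zeroʳ (A u c)) ⟩
    true                                    ∎)
    where open ≡-Reasoning

  pivot-spans-u∉Y : ∀ Y → Y ⊆ W → lookup Y u ≡ false → ∀ x → lookup (Rows Y) x ≡ true →
    InSpan (withRow piv (A′ v)) (Cols Y) (Rows Y) (A′ x)
  pivot-spans-u∉Y Y Y⊆W u∉Y x x∈ with rows-cases Y Y⊆W x∈
  ... | inj₁ refl = span-⁅⁆ (withRow piv (A′ v)) (Cols Y) v (v∈-∪⁅v⁆ Y) λ c _ → withRow-v piv (A′ v) c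
  ... | inj₂ (x≢v , x∈Y) = span-⁅⁆⊕ N (Cols Y) x (A x u) v x∈ (v∈-∪⁅v⁆ Y) λ c c∈ →
    trans (cong (λ t → N x c xor (A x u ∧ t)) (withRow-v piv (A′ v) c)) (entry c c∈)
    where
    N : Adj n
    N = withRow piv (A′ v)
    x≢u : x ≢ u
    x≢u = apart Y x∈Y u∉Y
    open ≡-Reasoning
    at-u : N x u xor (A x u ∧ A′ v u) ≡ A′ x u
    at-u = begin
      N x u xor (A x u ∧ A′ v u)   ≡⟨ cong₂ (λ s t → s xor (A x u ∧ t))
                                            (trans (withRow-off piv (A′ v) x≢v u≢v) (pivot-col-u x≢u x≢v))
                                            (trans (A′-u v) (A-loopless v)) ⟩
      A x v xor (A x u ∧ false)    ≡⟨ trans (cong (A x v xor_) (∧-zeroʳ (A x u))) (xor-identityʳ (A x v)) ⟩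
      A x v                        ≡⟨ A′-u x ⟨
      A′ x u                       ∎
    off-u : ∀ {c} → c ≢ v → lookup Y c ≡ false → c ≢ u → N x c xor (A x u ∧ A′ v c) ≡ A′ x c
    off-u {c} c≢v c∉Y c≢u = begin
      N x c xor (A x u ∧ A′ v c)
        ≡⟨ cong₂ (λ s t → s xor (A x u ∧ t))
                 (trans (withRow-off piv (A′ v) x≢v c≢v) (pivot-off (apart Y x∈Y c∉Y) x≢u x≢v c≢u c≢v))
                 (trans (A′-off v c≢u c≢v)
                        (trans (cong (λ t → A v c xor (t ∧ A u c)) (A-loopless v)) (xor-identityʳ _))) ⟩
      ((A x c xor (A x u ∧ A v c)) xor (A x v ∧ A u c)) xor (A x u ∧ A v c)
        ≡⟨ solve 3 (λ a p q → ((a :+ p) :+ q) :+ p := a :+ q) refl (A x c) (A x u ∧ A v c) (A x v ∧ A u c) ⟩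
      A x c xor (A x v ∧ A u c)
        ≡⟨ A′-off x c≢u c≢v ⟨
      A′ x c ∎
    entry : ∀ c → lookup (Cols Y) c ≡ true → N x c xor (A x u ∧ A′ v c) ≡ A′ x c
    entry c c∈ with cols-cases Y c∈
    ... | inj₁ refl = begin
      N x v xor (A x u ∧ A′ v v)   ≡⟨ cong₂ (λ s t → s xor (A x u ∧ t)) (withRow-col-v piv (A′ v) x≢v)
                                                                         (trans (A′-v v) vu) ⟩
      A x u ∧ true                 ≡⟨ ∧-identityʳ (A x u) ⟩
      A x u                        ≡⟨ A′-v x ⟨
      A′ x v                       ∎
    ... | inj₂ (c≢v , c∉Y) = [ (λ c≡u → subst (λ c → N x c xor (A x u ∧ A′ v c) ≡ A′ x c) (sym c≡u) at-u)
                             , off-u c≢v c∉Y ]′ (toSum (c ≟ u))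

  -- If u ∉ Y the rows of A need not be spanned by those of withRow piv r; the rows of A′, which has the
  -- same rank on these submatrices (A′-independent), are.
  pivot-contraction : ∀ Y l → Y ⊆ W → CutRankLt piv W Y l → Rank< A (Rows Y) (Cols Y) (suc l)
  pivot-contraction Y l Y⊆W ρY<l with lookup Y u in u∈Y?
  ... | true  = contraction-by-span A piv (A u) Y l Y⊆W (pivot-spans-u∈Y Y Y⊆W u∈Y?) ρY<l
  ... | false = λ Q Q⊆ eQ ind →
    contraction-by-span A′ piv (A′ v) Y l Y⊆W (pivot-spans-u∉Y Y Y⊆W u∈Y?) ρY<l Q Q⊆ eQ
      (A′-independent (Cols Y) Q u∈Cols (v∈-∪⁅v⁆ (W ─ Y)) ind)
    where
    u∈W : u ∈ W
    u∈W = x∉p⇒x∈∁p (u≢v ∘ x∈⁅y⁆⇒x≡y v)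
    u∈Cols : lookup (Cols Y) u ≡ true
    u∈Cols = ∈-∪⁅v⁆⁺ (W ─ Y) (∈⇒lookup (x∈p∧x∉q⇒x∈p─q u∈W λ u∈Y → false≢true (trans (sym u∈Y?) (∈⇒lookup u∈Y))))

  A⁺ : Adj n
  A⁺ x y = A x y ∨ (δ x v ∧ δ y v)

  A⁺-off-row : ∀ {x} c → x ≢ v → A⁺ x c ≡ A x c
  A⁺-off-row {x} c x≢v rewrite δ-≢ x≢v = ∨-identityʳ (A x c)

  A⁺-off-col : ∀ x {c} → c ≢ v → A⁺ x c ≡ A x c
  A⁺-off-col x {c} c≢v rewrite δ-≢ c≢v = trans (cong (A x c ∨_) (∧-zeroʳ (δ x v))) (∨-identityʳ (A x c))

  A⁺-vv : A⁺ v v ≡ true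
  A⁺-vv rewrite δ-refl v = ∨-zeroʳ (A v v)

  A*v-v : ∀ {c} → c ≢ v → (A * v) v c ≡ A v c
  A*v-v {c} c≢v =
    trans (*-≢ A v (c≢v ∘ sym)) (trans (cong (λ t → A v c xor (t ∧ A v c)) (A-loopless v)) (xor-identityʳ (A v c)))

  A*v-col-v : ∀ {x} → x ≢ v → (A * v) x v ≡ A v x
  A*v-col-v {x} x≢v = begin
    (A * v) x v                 ≡⟨ *-≢ A v x≢v ⟩
    A x v xor (A v x ∧ A v v)   ≡⟨ cong (λ t → A x v xor (A v x ∧ t)) (A-loopless v) ⟩
    A x v xor (A v x ∧ false)   ≡⟨ trans (cong (A x v xor_) (∧-zeroʳ (A v x))) (xor-identityʳ _) ⟩
    A x v                       ≡⟨ A-sym x v ⟩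
    A v x                       ∎
    where open ≡-Reasoning

  star-spans : ∀ Y → Y ⊆ W → ∀ x → lookup (Rows Y) x ≡ true → InSpan (withRow (A * v) (A⁺ v)) (Cols Y) (Rows Y) (A⁺ x)
  star-spans Y Y⊆W x x∈ with rows-cases Y Y⊆W x∈
  ... | inj₁ refl = span-⁅⁆ (withRow (A * v) (A⁺ v)) (Cols Y) v (v∈-∪⁅v⁆ Y) λ c _ → withRow-v (A * v) (A⁺ v) c
  ... | inj₂ (x≢v , x∈Y) = span-⁅⁆⊕ N (Cols Y) x (A x v) v x∈ (v∈-∪⁅v⁆ Y) λ c c∈ →
    trans (cong (λ t → N x c xor (A x v ∧ t)) (withRow-v (A * v) (A⁺ v) c)) (entry c c∈)
    where
    N : Adj n
    N = withRow (A * v) (A⁺ v)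
    open ≡-Reasoning
    entry : ∀ c → lookup (Cols Y) c ≡ true → N x c xor (A x v ∧ A⁺ v c) ≡ A⁺ x c
    entry c c∈ with cols-cases Y c∈
    ... | inj₁ refl = begin
      N x v xor (A x v ∧ A⁺ v v)   ≡⟨ cong₂ (λ s t → s xor (A x v ∧ t)) (withRow-col-v (A * v) (A⁺ v) x≢v) A⁺-vv ⟩
      A x v ∧ true                 ≡⟨ ∧-identityʳ (A x v) ⟩
      A x v                        ≡⟨ A⁺-off-row v x≢v ⟨
      A⁺ x v                       ∎
    ... | inj₂ (c≢v , c∉Y) = begin
      N x c xor (A x v ∧ A⁺ v c)
        ≡⟨ cong₂ (λ s t → s xor (A x v ∧ t)) (trans (withRow-off (A * v) (A⁺ v) x≢v c≢v) (*-≢ A v (apart Y x∈Y c∉Y)))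
                                             (A⁺-off-col v c≢v) ⟩
      (A x c xor (A v x ∧ A v c)) xor (A x v ∧ A v c)
        ≡⟨ cong (λ t → (A x c xor (t ∧ A v c)) xor (A x v ∧ A v c)) (A-sym v x) ⟩
      (A x c xor (A x v ∧ A v c)) xor (A x v ∧ A v c)
        ≡⟨ xor-cancelʳ (A x c) (A x v ∧ A v c) ⟩
      A x c
        ≡⟨ A⁺-off-row c x≢v ⟨
      A⁺ x c ∎

  star-contraction : ∀ Y l → Y ⊆ W → CutRankLt (A * v) W Y l → Rank< A⁺ (Rows Y) (Cols Y) (suc l)
  star-contraction Y l Y⊆W = contraction-by-span A⁺ (A * v) (A⁺ v) Y l Y⊆W (star-spans Y Y⊆W)

  star-rows-in-span : ∀ {C Z} → lookup Z v ≡ true → (∀ x c → lookup Z x ≡ true → lookup C c ≡ true → x ≡ c → x ≡ v) →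
    ∀ x → lookup Z x ≡ true → InSpan A C Z ((A * v) x)
  star-rows-in-span {C} {Z} v∈Z diagonal x x∈Z = span-⁅⁆⊕ A C x (A v x) v x∈Z v∈Z λ c c∈C → sym (entry c c∈C (x ≟ c))
    where
    entry : ∀ c → lookup C c ≡ true → Dec (x ≡ c) → (A * v) x c ≡ A x c xor (A v x ∧ A v c)
    entry c c∈C (no x≢c) = *-≢ A v x≢c
    entry c c∈C (yes refl) with refl ← diagonal x c x∈Z c∈C refl =
      trans (*-diag A v v) (trans (A-loopless v) (sym (cong₂ (λ s t → s xor (t ∧ t)) (A-loopless v) (A-loopless v))))

  rows-in-star-span : ∀ {C Z} → lookup Z v ≡ true → C ⊆ W → (∀ x c → lookup Z x ≡ true → lookup C c ≡ true → x ≢ c) →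
    ∀ x → lookup Z x ≡ true → InSpan (A * v) C Z (A x)
  rows-in-star-span {C} {Z} v∈Z C⊆W apart′ x x∈Z = span-⁅⁆⊕ (A * v) C x (A v x) v x∈Z v∈Z λ c c∈C → begin
    (A * v) x c xor (A v x ∧ (A * v) v c)           ≡⟨ cong₂ (λ s t → s xor (A v x ∧ t))
                                                             (*-≢ A v (apart′ x c x∈Z c∈C))
                                                             (A*v-v (∈W⇒≢v (⊆-elim C⊆W c c∈C))) ⟩
    (A x c xor (A v x ∧ A v c)) xor (A v x ∧ A v c) ≡⟨ xor-cancelʳ (A x c) (A v x ∧ A v c) ⟩
    A x c                                           ∎
    where open ≡-Reasoning

  deletion-vs-pivot : Comparison A A piv v
  deletion-vs-pivot = record
    { M                 = A
    ; deletion-bound    = λ _ _ _ ρX<k → ρX<k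
    ; contraction-bound = pivot-contraction
    ; rows-avoiding-v   = λ _ _ _ _ _ ind → ind
    ; rows-through-v    = λ _ _ Q Q⊆Z _ _ _ ind → Q , Q⊆Z , refl , ind
    }

  deletion-vs-star : Comparison A A (A * v) v
  deletion-vs-star = record
    { M                 = A⁺
    ; deletion-bound    = λ X k X⊆W → Rank<-cong (λ x c x∈X _ → sym (A⁺-off-row c (∈W⇒≢v (⊆-elim X⊆W x x∈X))))
    ; contraction-bound = star-contraction
    ; rows-avoiding-v   = λ C Q Q⊆W _ _ → independent-cong (λ x c x∈Q _ → sym (A⁺-off-row c (∈W⇒≢v (⊆-elim Q⊆W x x∈Q))))
    ; rows-through-v    = λ Z C Q Q⊆Z _ C⊆W _ ind →
        Q , Q⊆Z , refl , independent-cong (λ x c _ c∈C → sym (A⁺-off-col x (∈W⇒≢v (⊆-elim C⊆W c c∈C)))) ind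
    }

  star-vs-pivot : Comparison A (A * v) piv v
  star-vs-pivot = record
    { M                 = A * v
    ; deletion-bound    = λ _ _ _ ρX<k → ρX<k
    ; contraction-bound = λ Y l Y⊆W ρY<l →
        Rank<-span (star-rows-in-span {Cols Y} (v∈-∪⁅v⁆ Y) (diagonal Y Y⊆W)) (pivot-contraction Y l Y⊆W ρY<l)
    ; rows-avoiding-v   = λ C Q Q⊆W v∈C apart′ → independent-column-operation v (A v) v∈C λ x c x∈Q c∈C →
        column-v-cleared (∈W⇒≢v (⊆-elim Q⊆W x x∈Q)) (apart′ x c x∈Q c∈C)
    ; rows-through-v    = λ Z C Q Q⊆Z v∈Z C⊆W apart′ ind →
        span-transfer {w₁ = A} {w₂ = A * v} (rows-in-star-span v∈Z C⊆W apart′) Q⊆Z ind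
    }
    where
    open ≡-Reasoning
    column-v-cleared : ∀ {x c} → x ≢ v → x ≢ c → A x c ≡ (A * v) x c xor ((A * v) x v ∧ A v c)
    column-v-cleared {x} {c} x≢v x≢c = sym (begin
      (A * v) x c xor ((A * v) x v ∧ A v c)           ≡⟨ cong₂ (λ s t → s xor (t ∧ A v c)) (*-≢ A v x≢c) (A*v-col-v x≢v) ⟩
      (A x c xor (A v x ∧ A v c)) xor (A v x ∧ A v c) ≡⟨ xor-cancelʳ (A x c) (A v x ∧ A v c) ⟩
      A x c                                           ∎)
    diagonal : ∀ Y → Y ⊆ W → ∀ x c → lookup (Rows Y) x ≡ true → lookup (Cols Y) c ≡ true → x ≡ c → x ≡ v
    diagonal Y Y⊆W x c x∈ c∈ refl with rows-cases Y Y⊆W x∈ | cols-cases Y c∈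
    ... | inj₁ x≡v       | _              = x≡v
    ... | inj₂ _         | inj₁ c≡v       = c≡v
    ... | inj₂ (_ , x∈Y) | inj₂ (_ , x∉Y) = ⊥-elim (false≢true (trans (sym x∉Y) x∈Y))

-- Families of subsets of Fin n as finite tables, so that they can be enumerated.
FamilyTable : ℕ → Set
FamilyTable zero    = Bool
FamilyTable (suc n) = FamilyTable n × FamilyTable n

apply : ∀ {n} → FamilyTable n → Family n
apply {zero}  b         []          = b
apply {suc n} (t₀ , t₁) (false ∷ P) = apply t₀ P
apply {suc n} (t₀ , t₁) (true  ∷ P) = apply t₁ P

table : ∀ {n} → Family n → FamilyTable n
table {zero}  f = f []
table {suc n} f = table (λ P → f (false ∷ P)) , table (λ P → f (true ∷ P))

apply-table : ∀ {n} (f : Family n) P → apply (table f) P ≡ f P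
apply-table {zero}  f []          = refl
apply-table {suc n} f (false ∷ P) = apply-table (λ P → f (false ∷ P)) P
apply-table {suc n} f (true  ∷ P) = apply-table (λ P → f (true ∷ P)) P

anyTable? : ∀ {n} {P : FamilyTable n → Set} → (∀ t → Dec (P t)) → Dec (∃ P)
anyTable? {zero} P? with P? true | P? false
... | yes p | _     = yes (true , p)
... | no _  | yes p = yes (false , p)
... | no ¬p | no ¬q = no λ { (true , p) → ¬p p ; (false , q) → ¬q q }
anyTable? {suc n} P? =
  map′ (λ (t₀ , t₁ , p) → (t₀ , t₁) , p) (λ ((t₀ , t₁) , p) → t₀ , t₁ , p)
       (anyTable? {n} λ t₀ → anyTable? {n} λ t₁ → P? (t₀ , t₁))

allSubsets? : ∀ {n} {P : Subset n → Set} → (∀ X → Dec (P X)) → Dec (∀ X → P X)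
allSubsets? P? = map′ (λ ¬∃¬ X → decidable-stable (P? X) λ ¬p → ¬∃¬ (X , ¬p))
                      (λ ∀p (X , ¬p) → ¬p (∀p X))
                      (¬? (anySubset? (λ X → ¬? (P? X))))

module _ {n} (H : Adj n) (W : Subset n) (k : ℕ) (T : Family n) where

  private
    _∈T? : ∀ X → Dec (T X ≡ true)
    X ∈T? = T X ≟ᵇ true

  IsTangle? : Dec (IsTangle H W k T)
  IsTangle? = map′
    (λ (a , b , c , d , e) → record { inS = a ; oneOf = b ; notBoth = c ; noCover = d ; noCoSingl = e })
    (λ t → IsTangle.inS t , IsTangle.oneOf t , IsTangle.notBoth t , IsTangle.noCover t , IsTangle.noCoSingl t)
    (allSubsets? (λ X → X ∈T? →-dec InS? H W k X) ×-dec
     allSubsets? (λ X → InS? H W k X →-dec (X ∈T? ⊎-dec (W ─ X) ∈T?)) ×-dec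
     allSubsets? (λ X → InS? H W k X →-dec ¬? (X ∈T? ×-dec (W ─ X) ∈T?)) ×-dec
     allSubsets? (λ X → allSubsets? λ Y → allSubsets? λ Z →
       X ∈T? →-dec Y ∈T? →-dec Z ∈T? →-dec ¬? (≡-dec _≟ᵇ_ (X ∪ Y ∪ Z) W)) ×-dec
     allSubsets? (λ X → X ∈T? →-dec ¬? (suc ∣ X ∣ ≟ℕ ∣ W ∣)))

Induces? : ∀ {n} (A : Adj n) k (W : Subset n) (T₀ T : Family n) → Dec (Induces A k W T₀ T)
Induces? A k W T₀ T = allSubsets? λ X →
  (T X ≟ᵇ true →-dec InS? A ⊤ k X ×-dec T₀ (X ∩ W) ≟ᵇ true) ×-dec
  (InS? A ⊤ k X →-dec T₀ (X ∩ W) ≟ᵇ true →-dec T X ≟ᵇ true)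

module _ {n} {f g : Family n} (f≗g : ∀ X → f X ≡ g X) where

  IsTangle-cong : ∀ {H : Adj n} {W k} → IsTangle H W k f → IsTangle H W k g
  IsTangle-cong t = record
    { inS       = λ X e → IsTangle.inS t X (from X e)
    ; oneOf     = λ X i → Data.Sum.map (to X) (to _) (IsTangle.oneOf t X i)
    ; notBoth   = λ X i (a , b) → IsTangle.notBoth t X i (from X a , from _ b)
    ; noCover   = λ X Y Z a b c → IsTangle.noCover t X Y Z (from X a) (from Y b) (from Z c)
    ; noCoSingl = λ X e → IsTangle.noCoSingl t X (from X e)
    }
    where
    from : ∀ X → g X ≡ true → f X ≡ true
    from X = trans (f≗g X)
    to : ∀ X → f X ≡ true → g X ≡ true
    to X = trans (sym (f≗g X))

  Induces-cong : ∀ {A : Adj n} {k W} {T₀ T₀′ : Family n} → (∀ X → T₀ X ≡ T₀′ X) →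
    Induces A k W T₀ f → Induces A k W T₀′ g
  Induces-cong T₀≗T₀′ i X =
    (λ e → let (a , b) = proj₁ (i X) (trans (f≗g X) e) in a , trans (sym (T₀≗T₀′ _)) b) ,
    (λ a b → trans (sym (f≗g X)) (proj₂ (i X) a (trans (T₀≗T₀′ _) b)))

module Splitting {n} (A : Adj n) (v : Fin n) where

  private
    W : Subset n
    W = ∁ ⁅ v ⁆

  -- Bounding the order and giving the tangles as tables makes the existence of a split decidable.
  BoundedSplit : Adj n → Set
  BoundedSplit H =
    ∃ λ k → k < suc n × Σ (FamilyTable n) λ T → Σ (FamilyTable n) λ T₁ → Σ (FamilyTable n) λ T₂ →
      IsTangle A ⊤ k (apply T) × IsTangle H W k (apply T₁) × IsTangle H W k (apply T₂) ×
      Induces A k W (apply T₁) (apply T) × Induces A k W (apply T₂) (apply T) × ∃ λ X → apply T₁ X ≢ apply T₂ X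

  bounded-split? : ∀ H → Dec (BoundedSplit H)
  bounded-split? H = anyUpTo? (λ k → anyTable? λ T → anyTable? λ T₁ → anyTable? λ T₂ →
    IsTangle? A ⊤ k (apply T) ×-dec IsTangle? H W k (apply T₁) ×-dec IsTangle? H W k (apply T₂) ×-dec
    Induces? A k W (apply T₁) (apply T) ×-dec Induces? A k W (apply T₂) (apply T) ×-dec
    anySubset? (λ X → ¬? (apply T₁ X ≟ᵇ apply T₂ X))) (suc n)

  -- A set on which the two tangles differ is not small in G, so G has k independent rows.
  split-order≤n : ∀ {H k T T₁ T₂} → IsTangle H W k T₁ → Induces A k W T₁ T → Induces A k W T₂ T →
    ∀ X → T₁ X ≡ true → T₂ X ≡ false → k ≤ n
  split-order≤n {k = k} {T₁ = T₁} {T₂} t₁ i₁ i₂ X T₁X T₂X =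
    let (Q , _ , ∣Q∣≡k , _) = ¬rank<⇒independent A (⊤ ─ X) X k ¬small
    in subst (_≤ n) ∣Q∣≡k (∣p∣≤n Q)
    where
    X∩W≡X : X ∩ W ≡ X
    X∩W≡X = ⊆-antisym (p∩q⊆p X W) (∩-greatest ⊆-refl (proj₁ (IsTangle.inS t₁ X T₁X)))
    ¬small : ¬ Rank< A X (⊤ ─ X) k
    ¬small r = false≢true (trans (sym T₂X) (trans (cong T₂ (sym X∩W≡X))
                 (proj₂ (proj₁ (i₂ X) (proj₂ (i₁ X) (⊆⊤ , r) (trans (cong T₁ X∩W≡X) T₁X))))))

  ¬bounded-split⇒NoSplit : ∀ H → ¬ BoundedSplit H → NoSplit A H W
  ¬bounded-split⇒NoSplit H ¬split k _ T tT T₁ T₂ t₁ t₂ i₁ i₂ X with T₁ X ≟ᵇ T₂ X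
  ... | yes e = e
  ... | no ne = ⊥-elim (¬split (k , s≤s (order (T₁ X) refl) , table T , table T₁ , table T₂ ,
                 IsTangle-cong T≗ tT , IsTangle-cong T₁≗ t₁ , IsTangle-cong T₂≗ t₂ ,
                 Induces-cong T≗ T₁≗ i₁ , Induces-cong T≗ T₂≗ i₂ ,
                 X , λ e → ne (trans (sym (apply-table T₁ X)) (trans e (apply-table T₂ X)))))
    where
    T≗ : ∀ Y → T Y ≡ apply (table T) Y
    T≗ Y = sym (apply-table T Y)
    T₁≗ : ∀ Y → T₁ Y ≡ apply (table T₁) Y
    T₁≗ Y = sym (apply-table T₁ Y)
    T₂≗ : ∀ Y → T₂ Y ≡ apply (table T₂) Y
    T₂≗ Y = sym (apply-table T₂ Y)
    order : ∀ b → T₁ X ≡ b → k ≤ n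
    order true  e = split-order≤n t₁ i₁ i₂ X e (¬-not λ t → ne (trans e (sym t)))
    order false e = split-order≤n t₂ i₂ i₁ X (¬-not λ f → ne (trans e (sym f))) e

  bounded-split⇒Split : ∀ {H} → BoundedSplit H → Split A H v
  bounded-split⇒Split (k , _ , T , T₁ , T₂ , tT , t₁ , t₂ , i₁ , i₂ , X , ne) with apply T₁ X in e
  ... | true = record
    { k = k ; T = apply T ; T₁ = apply T₁ ; T₂ = apply T₂ ; X = X ; T-tangle = tT ; T₁-tangle = t₁ ; T₂-tangle = t₂
    ; T₁-induces = i₁ ; T₂-induces = i₂ ; T₁X = e
    ; T₂X̅ = [ (λ t → ⊥-elim (ne (sym t))) , id ]′ (IsTangle.oneOf t₂ X (IsTangle.inS t₁ X e)) }
  ... | false = record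
    { k = k ; T = apply T ; T₁ = apply T₂ ; T₂ = apply T₁ ; X = X ; T-tangle = tT ; T₁-tangle = t₂ ; T₂-tangle = t₁
    ; T₁-induces = i₂ ; T₂-induces = i₁ ; T₁X = T₂X
    ; T₂X̅ = [ (λ t → ⊥-elim (false≢true (trans (sym e) t))) , id ]′ (IsTangle.oneOf t₁ X (IsTangle.inS t₂ X T₂X)) }
    where
    T₂X : apply T₂ X ≡ true
    T₂X = ¬-not λ f → ne (sym f)

AtLeastTwo-map : ∀ {P Q R P′ Q′ R′ : Set} → (P → P′) → (Q → Q′) → (R → R′) → AtLeastTwo P Q R → AtLeastTwo P′ Q′ R′
AtLeastTwo-map f g h (inj₁ (p , q))        = inj₁ (f p , g q)
AtLeastTwo-map f g h (inj₂ (inj₁ (p , r))) = inj₂ (inj₁ (f p , h r))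
AtLeastTwo-map f g h (inj₂ (inj₂ (q , r))) = inj₂ (inj₂ (g q , h r))

at-most-one⇒AtLeastTwo-fail : ∀ {P Q R : Set} → Dec P → Dec Q → (P → ¬ Q) → (P → ¬ R) → (Q → ¬ R) →
  AtLeastTwo (¬ P) (¬ Q) (¬ R)
at-most-one⇒AtLeastTwo-fail (yes p) _       p-q p-r q-r = inj₂ (inj₂ (p-q p , p-r p))
at-most-one⇒AtLeastTwo-fail (no ¬p) (yes q) p-q p-r q-r = inj₂ (inj₁ (¬p , q-r q))
at-most-one⇒AtLeastTwo-fail (no ¬p) (no ¬q) p-q p-r q-r = inj₁ (¬p , ¬q)

theorem4p4 : (n : ℕ) (A : Adj n) → Simple A → (v u : Fin n) → A v u ≡ true →
    AtLeastTwo (NoSplit A A (∁ ⁅ v ⁆))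
               (NoSplit A (pivot A v u) (∁ ⁅ v ⁆))
               (NoSplit A (A * v) (∁ ⁅ v ⁆))
theorem4p4 n A simple v u vu =
  AtLeastTwo-map (¬bounded-split⇒NoSplit A) (¬bounded-split⇒NoSplit (pivot A v u)) (¬bounded-split⇒NoSplit (A * v))
    (at-most-one⇒AtLeastTwo-fail (bounded-split? A) (bounded-split? (pivot A v u))
      (λ s₁ s₂ → no-two-splits deletion-vs-pivot (bounded-split⇒Split s₁) (bounded-split⇒Split s₂))
      (λ s₁ s₃ → no-two-splits deletion-vs-star  (bounded-split⇒Split s₁) (bounded-split⇒Split s₃))
      (λ s₂ s₃ → no-two-splits star-vs-pivot     (bounded-split⇒Split s₃) (bounded-split⇒Split s₂)))
  where
  open Splitting A v
  open EdgeComparisons A simple v u vu
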